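{- Let $(F,O)$ be a MaxSAT instance, $\alpha$ a partial assignment, $v^*$ an integer, and $\mathcal{C}$ an $O$-compatible set of weighted local cores of $(F,O)$ relative to $\alpha$; let $|O|$ be the number of objective literals. (1) If $w(\mathcal{C})\ge v^*$, then there is a cutting planes derivation that derives the clause $C_{\mathcal{C}}$ from the constraint $O\le v^*-1$ and the clauses $C_q$ for every $q\in\mathcal{C}$, using at most $3|O|+2|\mathcal{C}|+1$ steps. (2) If for some objective literal $\ell$ unassigned by $\alpha$ we have $r(\ell,\mathcal{C})+w(\mathcal{C})\ge v^*$, then there is a cutting planes derivation that derives the clause $C_{\mathcal{C}}\vee\bar\ell$ from the constraint $O\le v^*-1$ and the clauses $C_q$ for every $q\in\mathcal{C}$, using at most $3|O|+2|\mathcal{C}|-2$ steps.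
   Context: All variables are Boolean; a literal is $x$ or $\bar x=1-x$. A pseudo-Boolean (PB) constraint is $\sum_i w_i\ell_i\ge A$ (or $\le$) with integer $w_i,A$ and literals $\ell_i$; a clause $\ell_1\vee\dots\vee\ell_m$ is the PB constraint $\sum_j \ell_j\ge 1$. A partial assignment is identified with the set of literals it makes true. A MaxSAT instance is $(F,O)$ with $F$ a conjunction of clauses and $O=\sum_i c_ib_i$ to be minimized, $c_i$ positive integers, $b_i$ distinct literals (objective literals); $c(\ell)=c_i$ if $\ell=b_i$ and $0$ otherwise. A weighted local core relative to $\alpha$ is a triple $q=\langle w,R,K\rangle$ with $w$ a positive integer, $R\subseteq\alpha$, $K$ a set of negations of objective literals, and $F\wedge R\wedge K\models\bot$. For such $q$, $C_q:=\bigvee_{\ell\in R\cup K}\bar\ell$. A set $\mathcal{C}$ of such cores is $O$-compatible if $\sum_{\langle w,R,K\rangle\in\mathcal{C},\,\bar\ell\in K}w\le c(\ell)$ for every objective literal $\ell$; $r(\ell,\mathcal{C})=c(\ell)-\sum_{\langle w,R,K\rangle\in\mathcal{C},\,\bar\ell\in K}w$; $w(\mathcal{C})=\sum_{\langle w,R,K\rangle\in\mathcal{C}}w$; and $C_{\mathcal{C}}:=\bigvee_{\langle w,R,K\rangle\in\mathcal{C},\ \ell\in R}\bar\ell$. A cutting planes derivation is a sequence of steps, each one of: a literal axiom (add $\ell\ge 0$ for a literal $\ell$); multiplication of a derived constraint by a positive integer; addition of two derived constraints; division (from a normalized constraint $\sum_i w_i\ell_i\ge A$ with nonnegative $w_i,A$,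 and positive integer $c$, derive $\sum_i\lceil w_i/c\rceil\ell_i\ge\lceil A/c\rceil$); saturation (from normalized $\sum_i a_i\ell_i\ge A$ derive $\sum_i\min(a_i,A)\ell_i\ge A$). Constraints are identified up to normalization using $\bar x=1-x$ and merging of terms. -}

module Defs where

open import Data.Nat as ℕ using (ℕ; zero; suc; _∸_)
open import Data.Nat.DivMod using (_/_)
open import Data.Nat.ListAction using (sum)
open import Data.Integer as ℤ using (ℤ; +_; -_; ∣_∣; _⊓_)
open import Data.Bool using (Bool; true; false; not; if_then_else_)
open import Data.Product using (Σ; ∃; _×_; _,_; proj₁; proj₂)
open import Data.List using (List; []; _∷_; _++_; [_]; map; concatMap; length; deduplicate; filter)
open import Data.List.Relation.Unary.All using (All)
open import Data.List.Relation.Unary.Any using (Any)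
open import Data.List.Relation.Unary.Unique.Propositional using (Unique)
open import Data.List.Relation.Unary.AllPairs using (AllPairs)
open import Data.List.Membership.Propositional using (_∈_; _∉_)
open import Data.Empty using (⊥)
open import Relation.Nullary using (¬_; yes; no)
open import Relation.Nullary.Decidable using (⌊_⌋)
open import Relation.Binary.PropositionalEquality using (_≡_; refl; cong)
open import Relation.Binary.Definitions using (DecidableEquality)

data Lit : Set where
  pos : ℕ → Lit
  neg : ℕ → Lit

var : Lit → ℕ
var (pos x) = x
var (neg x) = x

~_ : Lit → Lit
~ pos x = neg x
~ neg x = pos x

_≟L_ : DecidableEquality Lit
pos x ≟L pos y with x ℕ.≟ y
... | yes refl = yes refl
... | no x≢y = no λ { refl → x≢y refl }
pos x ≟L neg y = no λ ()
neg x ≟L pos y = no λ ()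
neg x ≟L neg y with x ℕ.≟ y
... | yes refl = yes refl
... | no x≢y = no λ { refl → x≢y refl }

-- Pseudo-Boolean constraints  Σ w_i ℓ_i ≥ A  (integer w_i, A).
-- A "≤" constraint Σ w_i ℓ_i ≤ A is represented as Σ (-w_i) ℓ_i ≥ -A.

record PB : Set where
  constructor pb
  field
    terms : List (ℤ × Lit)
    rhs   : ℤ
open PB public

-- Variable form (using x̄ = 1 - x): coefficient of variable x
termCoef : ℕ → ℤ × Lit → ℤ
termCoef x (w , pos y) = if ⌊ x ℕ.≟ y ⌋ then w else + 0
termCoef x (w , neg y) = if ⌊ x ℕ.≟ y ⌋ then - w else + 0

sumℤ : List ℤ → ℤ
sumℤ [] = + 0
sumℤ (a ∷ as) = a ℤ.+ sumℤ as

coef : PB → ℕ → ℤ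
coef C x = sumℤ (map (termCoef x) (terms C))

-- constant moved to the right-hand side by x̄ = 1 - x
negShift : ℤ × Lit → ℤ
negShift (w , pos y) = + 0
negShift (w , neg y) = w

rhsV : PB → ℤ
rhsV C = rhs C ℤ.- sumℤ (map negShift (terms C))

-- Identification of constraints up to normalization
_≈_ : PB → PB → Set
C ≈ D = (∀ x → coef C x ≡ coef D x) × (rhsV C ≡ rhsV D)

IsNormalized : PB → Set
IsNormalized C = All (λ t → + 0 ℤ.≤ proj₁ t) (terms C) × Unique (map (λ t → var (proj₂ t)) (terms C))

axiomPB : Lit → PB
axiomPB ℓ = pb [ (+ 1 , ℓ) ] (+ 0)

scalePB : ℕ → PB → PB   -- multiplication by the positive integer suc k
scalePB k C = pb (map (λ t → (+ suc k ℤ.* proj₁ t , proj₂ t)) (terms C)) (+ suc k ℤ.* rhs C)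

addPB : PB → PB → PB
addPB C D = pb (terms C ++ terms D) (rhs C ℤ.+ rhs D)

-- ⌈ a / (suc k) ⌉ for a nonnegative integer a
ceilDiv : ℤ → ℕ → ℤ
ceilDiv a k = + ((∣ a ∣ ℕ.+ k) / suc k)

dividePB : ℕ → PB → PB   -- division by the positive integer suc k
dividePB k C = pb (map (λ t → (ceilDiv (proj₁ t) k , proj₂ t)) (terms C)) (ceilDiv (rhs C) k)

saturatePB : PB → PB
saturatePB C = pb (map (λ t → (proj₁ t ⊓ rhs C , proj₂ t)) (terms C)) (rhs C)

data Justified (av : List PB) (new : PB) : Set where
  axiom    : (ℓ : Lit) → new ≈ axiomPB ℓ → Justified av new
  multiply : (C : PB) → C ∈ av → (k : ℕ) → new ≈ scalePB k C → Justified av new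
  addition : (C D : PB) → C ∈ av → D ∈ av → new ≈ addPB C D → Justified av new
  division : (C N : PB) → C ∈ av → N ≈ C → IsNormalized N → + 0 ℤ.≤ rhs N →
             (k : ℕ) → new ≈ dividePB k N → Justified av new
  saturation : (C N : PB) → C ∈ av → N ≈ C → IsNormalized N → + 0 ℤ.≤ rhs N →
             new ≈ saturatePB N → Justified av new

data Derivation (P : List PB) : List PB → Set where
  done : Derivation P []
  step : ∀ {ss s} → Derivation P ss → Justified (P ++ ss) s → Derivation P (ss ++ [ s ])

Derives : List PB → PB → ℕ → Set
Derives P T n = Σ (List PB) λ ss → Derivation P ss × length ss ℕ.≤ n × Any (_≈ T) (P ++ ss)

Clause : Set
Clause = List Lit

-- the clause ℓ₁ ∨ … ∨ ℓ_m (as a set of literals) as the PB constraint Σ ℓ_j ≥ 1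
clausePB : List Lit → PB
clausePB ls = pb (map (λ ℓ → (+ 1 , ℓ)) (deduplicate _≟L_ ls)) (+ 1)

evalLit : (ℕ → Bool) → Lit → Bool
evalLit τ (pos x) = τ x
evalLit τ (neg x) = not (τ x)

IsTrue : (ℕ → Bool) → Lit → Set
IsTrue τ ℓ = evalLit τ ℓ ≡ true

SatClause : (ℕ → Bool) → Clause → Set
SatClause τ C = Any (IsTrue τ) C

record MaxSAT : Set where
  field
    F : List Clause
    O : List (ℕ × Lit)                 -- O = Σ c_i b_i
    costPos  : All (λ t → 0 ℕ.< proj₁ t) O
    distinct : Unique (map proj₂ O)
open MaxSAT public

objLits : MaxSAT → List Lit
objLits I = map proj₂ (O I)

cost : MaxSAT → Lit → ℕ
cost I ℓ = sum (map (λ t → if ⌊ proj₂ t ≟L ℓ ⌋ then proj₁ t else 0) (O I))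

objLeq : MaxSAT → ℤ → PB
objLeq I v = pb (map (λ t → (- (+ proj₁ t) , proj₂ t)) (O I)) (- (v ℤ.- + 1))

-- partial assignments (sets of literals made true), consistent
Consistent : List Lit → Set
Consistent α = ∀ x → pos x ∈ α → neg x ∈ α → ⊥

Unassigned : List Lit → Lit → Set
Unassigned α ℓ = ℓ ∉ α × (~ ℓ) ∉ α

record Core : Set where
  constructor ⟨_,_,_⟩
  field
    wt : ℕ
    R  : List Lit
    K  : List Lit
open Core public

IsCore : MaxSAT → List Lit → Core → Set
IsCore I α q =
  0 ℕ.< wt q ×
  Unique (R q) × All (_∈ α) (R q) ×
  Unique (K q) × All (λ k → Σ Lit λ ℓ → ℓ ∈ objLits I × k ≡ ~ ℓ) (K q) ×
  (∀ (τ : ℕ → Bool) → All (SatClause τ) (F I) → All (IsTrue τ) (R q) → All (IsTrue τ) (K q) → ⊥)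

SameSet : List Lit → List Lit → Set
SameSet A B = (∀ ℓ → ℓ ∈ A → ℓ ∈ B) × (∀ ℓ → ℓ ∈ B → ℓ ∈ A)

SameCore : Core → Core → Set
SameCore p q = wt p ≡ wt q × SameSet (R p) (R q) × SameSet (K p) (K q)

-- a set of cores: list without repetitions (as triples of a number and two sets)
IsCoreSet : List Core → Set
IsCoreSet 𝒞 = AllPairs (λ p q → ¬ SameCore p q) 𝒞

load : List Core → Lit → ℕ
load 𝒞 ℓ = sum (map (λ q → if ⌊ Any? (~ ℓ) (K q) ⌋ then wt q else 0) 𝒞)
  where
  open import Data.List.Membership.DecPropositional _≟L_ using (_∈?_)
  Any? = _∈?_

Compatible : MaxSAT → List Core → Set
Compatible I 𝒞 = ∀ ℓ → ℓ ∈ objLits I → load 𝒞 ℓ ℕ.≤ cost I ℓ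

residual : MaxSAT → List Core → Lit → ℤ
residual I 𝒞 ℓ = + cost I ℓ ℤ.- + load 𝒞 ℓ

weight : List Core → ℕ
weight 𝒞 = sum (map wt 𝒞)

coreClause : Core → PB
coreClause q = clausePB (map ~_ (R q ++ K q))

coreSetLits : List Core → List Lit
coreSetLits 𝒞 = concatMap (λ q → map ~_ (R q)) 𝒞

premises : MaxSAT → ℤ → List Core → List PB
premises I v 𝒞 = objLeq I v ∷ map coreClause 𝒞

{-# OPTIONS --safe #-}
module Submission where

-- Both clauses come from one division of a nonnegative combination of the premises: μ copies of
-- O ≤ v - 1, each core clause C_q about μ·w_q times, and for every objective literal b just enough
-- copies of the axiom b ≥ 0 to lift its coefficient -μ·c(b) to what the cores contribute through
-- their R-parts; compatibility of the cores makes these multipliers nonnegative. What remains is a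
-- constraint over the literals of C_𝒞 alone, whose variables are distinct since α is consistent, of
-- degree μ·(w(𝒞) - v + 1) ≥ 1, so dividing by a large enough number yields the clause. For (2) the
-- axiom for ℓ is skipped: ℓ keeps a negative coefficient -e, which normalisation turns into e·ℓ̄,
-- and the degree becomes μ·(r(ℓ,𝒞) + w(𝒞) - v + 1). A core costs at most 2 steps, an objective
-- literal at most 3 (ℓ none), and the division one more.

open import Defs
open import Data.Nat using (ℕ; _+_; _*_; _∸_; _≤_)
open import Data.Integer using (ℤ; +_) renaming (_≤_ to _≤ℤ_; _+_ to _+ℤ_)
open import Data.Product using (_×_)
open import Data.List using (List; length; _++_; [_])
open import Data.List.Relation.Unary.All using (All)
open import Data.List.Membership.Propositional using (_∈_)

open import Data.Bool using (Bool; true; false; if_then_else_)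
open import Data.Empty using (⊥; ⊥-elim)
open import Data.Integer using (-_; ∣_∣; +≤+) renaming (_*_ to _*ℤ_; _-_ to _-ℤ_)
import Data.Integer.Properties as ℤₚ
import Data.Integer.Tactic.RingSolver as ℤ-Ring
open import Data.List using ([]; _∷_; map; deduplicate)
open import Data.List.Properties using (map-∘; ++-assoc; length-++)
open import Data.List.Membership.DecPropositional _≟L_ using (_∈?_)
open import Data.List.Membership.Propositional using (_∉_; find)
open import Data.List.Membership.Propositional.Properties
  using (∈-++⁺ˡ; ∈-++⁺ʳ; ∈-++⁻; ∈-map⁺; ∈-map⁻; ∈-deduplicate⁺; ∈-deduplicate⁻)
open import Data.List.Relation.Unary.All as All using ([]; _∷_)
import Data.List.Relation.Unary.All.Properties as Allₚ
open import Data.List.Relation.Unary.Any as Any using (here; there)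
open import Data.List.Relation.Unary.AllPairs using ([]; _∷_)
open import Data.List.Relation.Unary.Unique.Propositional using (Unique)
open import Data.List.Relation.Unary.Unique.DecPropositional.Properties using (deduplicate-!)
open import Data.Nat using (zero; suc; pred; _<_; z≤n; s≤s; >-nonZero)
open import Data.Nat.DivMod using (_/_; m/n≡1+[m∸n]/n; m<n⇒m/n≡0)
open import Data.Nat.ListAction using (sum)
import Data.Nat.Properties as ℕₚ
import Data.Nat.Tactic.RingSolver as ℕ-Ring
open import Data.Product using (Σ; _,_; proj₁; proj₂)
open import Data.Sum using (_⊎_; inj₁; inj₂)
open import Function using (_∘_)
open import Relation.Binary.PropositionalEquality
  using (_≡_; _≢_; refl; sym; trans; cong; cong₂; subst; module ≡-Reasoning)
open import Relation.Nullary using (¬_; Dec; yes; no)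
open import Relation.Nullary.Decidable using (⌊_⌋; _×-dec_; isYes≗does; dec-true; dec-false)

private variable
  A : Set

isYes-true : ∀ {P : Set} (p? : Dec P) → P → ⌊ p? ⌋ ≡ true
isYes-true p? p = trans (isYes≗does p?) (dec-true p? p)

isYes-false : ∀ {P : Set} (p? : Dec P) → ¬ P → ⌊ p? ⌋ ≡ false
isYes-false p? ¬p = trans (isYes≗does p?) (dec-false p? ¬p)

𝟙 : Bool → ℕ
𝟙 b = if b then 1 else 0

𝟙≤1 : ∀ b → 𝟙 b ≤ 1
𝟙≤1 true = s≤s z≤n
𝟙≤1 false = z≤n

~-involutive : ∀ m → ~ ~ m ≡ m
~-involutive (pos _) = refl
~-involutive (neg _) = refl

∈-map-~⁺ : ∀ {m L} → ~ m ∈ L → m ∈ map ~_ L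
∈-map-~⁺ {m} {L} p = subst (_∈ map ~_ L) (~-involutive m) (∈-map⁺ ~_ p)

∈-map-~⁻ : ∀ {m L} → m ∈ map ~_ L → ~ m ∈ L
∈-map-~⁻ {L = L} p with ∈-map⁻ ~_ p
... | n , n∈L , refl = subst (_∈ L) (sym (~-involutive n)) n∈L

sameVar⇒≡⊎~ : ∀ m n → var m ≡ var n → m ≡ n ⊎ n ≡ ~ m
sameVar⇒≡⊎~ (pos x) (pos .x) refl = inj₁ refl
sameVar⇒≡⊎~ (pos x) (neg .x) refl = inj₂ refl
sameVar⇒≡⊎~ (neg x) (pos .x) refl = inj₂ refl
sameVar⇒≡⊎~ (neg x) (neg .x) refl = inj₁ refl

consistent-~ : ∀ {α} → Consistent α → ∀ m → m ∈ α → ~ m ∈ α → ⊥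
consistent-~ cons (pos x) m∈α ~m∈α = cons x m∈α ~m∈α
consistent-~ cons (neg x) m∈α ~m∈α = cons x ~m∈α m∈α

Σℕ : List A → (A → ℕ) → ℕ
Σℕ xs f = sum (map f xs)

Σℕ-cong : ∀ (xs : List A) {f g : A → ℕ} → (∀ {x} → x ∈ xs → f x ≡ g x) → Σℕ xs f ≡ Σℕ xs g
Σℕ-cong [] _ = refl
Σℕ-cong (x ∷ xs) f≡g = cong₂ _+_ (f≡g (here refl)) (Σℕ-cong xs (f≡g ∘ there))

Σℕ-zero : ∀ (xs : List A) {f : A → ℕ} → (∀ {x} → x ∈ xs → f x ≡ 0) → Σℕ xs f ≡ 0
Σℕ-zero [] _ = refl
Σℕ-zero (x ∷ xs) f≡0 = cong₂ _+_ (f≡0 (here refl)) (Σℕ-zero xs (f≡0 ∘ there))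

Σℕ-+ : ∀ (xs : List A) (f g : A → ℕ) → Σℕ xs (λ x → f x + g x) ≡ Σℕ xs f + Σℕ xs g
Σℕ-+ [] f g = refl
Σℕ-+ (x ∷ xs) f g = trans (cong (_+_ (f x + g x)) (Σℕ-+ xs f g)) (interchange (f x) (g x) _ _)
  where
  interchange : ∀ a b c d → a + b + (c + d) ≡ a + c + (b + d)
  interchange = ℕ-Ring.solve-∀

Σℕ-*ˡ : ∀ (xs : List A) (c : ℕ) (f : A → ℕ) → Σℕ xs (λ x → c * f x) ≡ c * Σℕ xs f
Σℕ-*ˡ [] c f = sym (ℕₚ.*-zeroʳ c)
Σℕ-*ˡ (x ∷ xs) c f = trans (cong (_+_ (c * f x)) (Σℕ-*ˡ xs c f)) (sym (ℕₚ.*-distribˡ-+ c (f x) _))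

Σℕ-mono : ∀ (xs : List A) {f g : A → ℕ} → (∀ {x} → x ∈ xs → f x ≤ g x) → Σℕ xs f ≤ Σℕ xs g
Σℕ-mono [] _ = z≤n
Σℕ-mono (x ∷ xs) f≤g = ℕₚ.+-mono-≤ (f≤g (here refl)) (Σℕ-mono xs (f≤g ∘ there))

∈⇒≤Σℕ : ∀ {xs : List A} (f : A → ℕ) {x} → x ∈ xs → f x ≤ Σℕ xs f
∈⇒≤Σℕ f (here refl) = ℕₚ.m≤m+n _ _
∈⇒≤Σℕ {xs = y ∷ _} f (there x∈xs) = ℕₚ.≤-trans (∈⇒≤Σℕ f x∈xs) (ℕₚ.m≤n+m _ (f y))

Σℕ≡0⇒≡0 : ∀ {xs : List A} (f : A → ℕ) → Σℕ xs f ≡ 0 → ∀ {x} → x ∈ xs → f x ≡ 0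
Σℕ≡0⇒≡0 f Σ≡0 (here refl) = ℕₚ.m+n≡0⇒m≡0 _ Σ≡0
Σℕ≡0⇒≡0 {xs = y ∷ _} f Σ≡0 (there x∈xs) = Σℕ≡0⇒≡0 f (ℕₚ.m+n≡0⇒n≡0 (f y) Σ≡0) x∈xs

Σℕ≤*length : ∀ (xs : List A) {f : A → ℕ} {c} → (∀ x → f x ≤ c) → Σℕ xs f ≤ c * length xs
Σℕ≤*length [] f≤c = z≤n
Σℕ≤*length (x ∷ xs) {c = c} f≤c =
  ℕₚ.≤-trans (ℕₚ.+-mono-≤ (f≤c x) (Σℕ≤*length xs f≤c)) (ℕₚ.≤-reflexive (sym (ℕₚ.*-suc c (length xs))))

+Σℕ≤*length : ∀ (xs : List A) {f : A → ℕ} {c} d → (∀ x → f x ≤ c) → ∀ {y} → y ∈ xs → d + f y ≤ c →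
              d + Σℕ xs f ≤ c * length xs
+Σℕ≤*length (x ∷ xs) {f} {c} d f≤c (here refl) gap = begin
  d + (f x + Σℕ xs f)  ≡⟨ ℕₚ.+-assoc d (f x) _ ⟨
  d + f x + Σℕ xs f    ≤⟨ ℕₚ.+-mono-≤ gap (Σℕ≤*length xs f≤c) ⟩
  c + c * length xs    ≡⟨ ℕₚ.*-suc c (length xs) ⟨
  c * suc (length xs)  ∎
  where open ℕₚ.≤-Reasoning
+Σℕ≤*length (x ∷ xs) {f} {c} d f≤c (there y∈xs) gap = begin
  d + (f x + Σℕ xs f)  ≡⟨ ℕₚ.+-comm d _ ⟩
  (f x + Σℕ xs f) + d  ≡⟨ ℕₚ.+-assoc (f x) _ d ⟩
  f x + (Σℕ xs f + d)  ≡⟨ cong (_+_ (f x)) (ℕₚ.+-comm _ d) ⟩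
  f x + (d + Σℕ xs f)  ≤⟨ ℕₚ.+-mono-≤ (f≤c x) (+Σℕ≤*length xs d f≤c y∈xs gap) ⟩
  c + c * length xs    ≡⟨ ℕₚ.*-suc c (length xs) ⟨
  c * suc (length xs)  ∎
  where open ℕₚ.≤-Reasoning

Σℤ : List A → (A → ℤ) → ℤ
Σℤ xs f = sumℤ (map f xs)

Σℤ-cong : ∀ (xs : List A) {f g : A → ℤ} → (∀ {x} → x ∈ xs → f x ≡ g x) → Σℤ xs f ≡ Σℤ xs g
Σℤ-cong [] _ = refl
Σℤ-cong (x ∷ xs) f≡g = cong₂ _+ℤ_ (f≡g (here refl)) (Σℤ-cong xs (f≡g ∘ there))

Σℤ-zero : ∀ (xs : List A) {f : A → ℤ} → (∀ {x} → x ∈ xs → f x ≡ + 0) → Σℤ xs f ≡ + 0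
Σℤ-zero [] _ = refl
Σℤ-zero (x ∷ xs) f≡0 = cong₂ _+ℤ_ (f≡0 (here refl)) (Σℤ-zero xs (f≡0 ∘ there))

Σℤ-+ : ∀ (xs : List A) (f g : A → ℤ) → Σℤ xs (λ x → f x +ℤ g x) ≡ Σℤ xs f +ℤ Σℤ xs g
Σℤ-+ [] f g = refl
Σℤ-+ (x ∷ xs) f g = trans (cong (_+ℤ_ (f x +ℤ g x)) (Σℤ-+ xs f g)) (interchange (f x) (g x) _ _)
  where
  interchange : ∀ a b c d → a +ℤ b +ℤ (c +ℤ d) ≡ a +ℤ c +ℤ (b +ℤ d)
  interchange = ℤ-Ring.solve-∀

Σℤ-- : ∀ (xs : List A) (f g : A → ℤ) → Σℤ xs (λ x → f x -ℤ g x) ≡ Σℤ xs f -ℤ Σℤ xs g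
Σℤ-- [] f g = refl
Σℤ-- (x ∷ xs) f g = trans (cong (_+ℤ_ (f x -ℤ g x)) (Σℤ-- xs f g)) (interchange (f x) (g x) _ _)
  where
  interchange : ∀ a b c d → a -ℤ b +ℤ (c -ℤ d) ≡ a +ℤ c -ℤ (b +ℤ d)
  interchange = ℤ-Ring.solve-∀

Σℤ-*ˡ : ∀ (xs : List A) (c : ℤ) (f : A → ℤ) → Σℤ xs (λ x → c *ℤ f x) ≡ c *ℤ Σℤ xs f
Σℤ-*ˡ [] c f = sym (ℤₚ.*-zeroʳ c)
Σℤ-*ˡ (x ∷ xs) c f = trans (cong (_+ℤ_ (c *ℤ f x)) (Σℤ-*ˡ xs c f)) (sym (ℤₚ.*-distribˡ-+ c (f x) _))

Σℤ-++ : ∀ (xs ys : List A) (f : A → ℤ) → Σℤ (xs ++ ys) f ≡ Σℤ xs f +ℤ Σℤ ys f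
Σℤ-++ [] ys f = sym (ℤₚ.+-identityˡ _)
Σℤ-++ (x ∷ xs) ys f = trans (cong (_+ℤ_ (f x)) (Σℤ-++ xs ys f)) (sym (ℤₚ.+-assoc (f x) _ _))

Σℤ-map : ∀ {B : Set} (xs : List A) (g : A → B) (f : B → ℤ) → Σℤ (map g xs) f ≡ Σℤ xs (f ∘ g)
Σℤ-map xs g f = cong sumℤ (sym (map-∘ xs))

Σℤ-pos : ∀ (xs : List A) (f : A → ℕ) → Σℤ xs (λ x → + f x) ≡ + Σℕ xs f
Σℤ-pos [] f = refl
Σℤ-pos (x ∷ xs) f = trans (cong (_+ℤ_ (+ f x)) (Σℤ-pos xs f)) (sym (ℤₚ.pos-+ (f x) _))

Σℤ-delta : ∀ {xs : List A} (f : A → ℤ) {x} → Unique xs → x ∈ xs → (∀ {y} → y ≢ x → f y ≡ + 0) →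
           Σℤ xs f ≡ f x
Σℤ-delta {xs = x ∷ xs} f (x∉xs ∷ _) (here refl) vanish =
  trans (cong (_+ℤ_ (f x)) (Σℤ-zero xs (λ y∈xs → vanish (λ { refl → All.lookup x∉xs y∈xs refl }))))
        (ℤₚ.+-identityʳ (f x))
Σℤ-delta {xs = y ∷ xs} f (y∉xs ∷ unique) (there x∈xs) vanish =
  trans (cong₂ _+ℤ_ (vanish (λ { refl → All.lookup y∉xs x∈xs refl })) (Σℤ-delta f unique x∈xs vanish))
        (ℤₚ.+-identityˡ _)

-- Coefficient of the literal m itself, as opposed to that of its variable in coef.
termOn : Lit → ℤ × Lit → ℤ
termOn m (w , n) = if ⌊ n ≟L m ⌋ then w else + 0

termOn-≡ : ∀ m w → termOn m (w , m) ≡ w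
termOn-≡ m w = cong (if_then w else + 0) (isYes-true (m ≟L m) refl)

termOn-≢ : ∀ m n w → n ≢ m → termOn m (w , n) ≡ + 0
termOn-≢ m n w n≢m = cong (if_then w else + 0) (isYes-false (n ≟L m) n≢m)

litCoef : PB → Lit → ℤ
litCoef C m = Σℤ (terms C) (termOn m)

weightedSum : (Lit → ℕ) → List Lit → ℤ → PB
weightedSum G H z = pb (map (λ h → (+ G h , h)) H) z

litCoef-addPB : ∀ C D m → litCoef (addPB C D) m ≡ litCoef C m +ℤ litCoef D m
litCoef-addPB C D m = Σℤ-++ (terms C) (terms D) (termOn m)

litCoef-scalePB : ∀ k C m → litCoef (scalePB k C) m ≡ + suc k *ℤ litCoef C m
litCoef-scalePB k C m = begin
  litCoef (scalePB k C) m                                ≡⟨ Σℤ-map (terms C) _ (termOn m) ⟩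
  Σℤ (terms C) (λ t → termOn m (+ suc k *ℤ proj₁ t , proj₂ t)) ≡⟨ Σℤ-cong (terms C) (λ {t} _ → termOn-* t) ⟩
  Σℤ (terms C) (λ t → + suc k *ℤ termOn m t)             ≡⟨ Σℤ-*ˡ (terms C) (+ suc k) (termOn m) ⟩
  + suc k *ℤ litCoef C m                                 ∎
  where
  open ≡-Reasoning
  termOn-* : ∀ t → termOn m (+ suc k *ℤ proj₁ t , proj₂ t) ≡ + suc k *ℤ termOn m t
  termOn-* (w , n) with ⌊ n ≟L m ⌋
  ... | true = refl
  ... | false = sym (ℤₚ.*-zeroʳ (+ suc k))

litCoef-axiomPB : ∀ ℓ m → litCoef (axiomPB ℓ) m ≡ + 𝟙 ⌊ ℓ ≟L m ⌋
litCoef-axiomPB ℓ m with ⌊ ℓ ≟L m ⌋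
... | true = refl
... | false = refl

litCoef-objLeq : ∀ I v m → litCoef (objLeq I v) m ≡ - + cost I m
litCoef-objLeq I v m = begin
  litCoef (objLeq I v) m                                  ≡⟨ Σℤ-map (O I) _ (termOn m) ⟩
  Σℤ (O I) (λ t → termOn m (- + proj₁ t , proj₂ t))       ≡⟨ Σℤ-cong (O I) (λ {t} _ → termOn-neg t) ⟩
  Σℤ (O I) (λ t → - + costOn t)                           ≡⟨ Σℤ-neg (O I) ⟩
  - Σℤ (O I) (λ t → + costOn t)                           ≡⟨ cong -_ (Σℤ-pos (O I) costOn) ⟩
  - + cost I m                                            ∎
  where
  open ≡-Reasoning
  costOn : ℕ × Lit → ℕ
  costOn t = if ⌊ proj₂ t ≟L m ⌋ then proj₁ t else 0
  termOn-neg : ∀ t → termOn m (- + proj₁ t , proj₂ t) ≡ - + costOn t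
  termOn-neg (c , n) with ⌊ n ≟L m ⌋
  ... | true = refl
  ... | false = refl
  Σℤ-neg : ∀ (ts : List (ℕ × Lit)) → Σℤ ts (λ t → - + costOn t) ≡ - Σℤ ts (λ t → + costOn t)
  Σℤ-neg [] = refl
  Σℤ-neg (t ∷ ts) = trans (cong (_+ℤ_ (- + costOn t)) (Σℤ-neg ts)) (sym (ℤₚ.neg-distrib-+ (+ costOn t) _))

litCoef-weightedSum-∈ : ∀ G {H} z {m} → Unique H → m ∈ H → litCoef (weightedSum G H z) m ≡ + G m
litCoef-weightedSum-∈ G {H} z {m} unique m∈H =
  trans (Σℤ-map H _ (termOn m))
        (trans (Σℤ-delta _ unique m∈H (λ {h} h≢m → termOn-≢ m h (+ G h) h≢m)) (termOn-≡ m _))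

litCoef-weightedSum-∉ : ∀ G {H} z {m} → m ∉ H → litCoef (weightedSum G H z) m ≡ + 0
litCoef-weightedSum-∉ G {H} z {m} m∉H =
  trans (Σℤ-map H _ (termOn m))
        (Σℤ-zero H (λ {h} h∈H → termOn-≢ m h (+ G h) (λ { refl → m∉H h∈H })))

litCoef-clausePB : ∀ L m → litCoef (clausePB L) m ≡ + 𝟙 ⌊ m ∈? L ⌋
litCoef-clausePB L m with m ∈? L
... | yes m∈L = litCoef-weightedSum-∈ (λ _ → 1) (+ 1) (deduplicate-! _≟L_ L) (∈-deduplicate⁺ _≟L_ m∈L)
... | no m∉L = litCoef-weightedSum-∉ (λ _ → 1) (+ 1) (m∉L ∘ ∈-deduplicate⁻ _≟L_ L)

≈-refl : ∀ {C} → C ≈ C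
≈-refl = (λ _ → refl) , refl

≈-trans : ∀ {C D E} → C ≈ D → D ≈ E → C ≈ E
≈-trans (coef≡ , rhs≡) (coef≡′ , rhs≡′) = (λ x → trans (coef≡ x) (coef≡′ x)) , trans rhs≡ rhs≡′

termCoef≡termOn-pos-neg : ∀ x t → termCoef x t ≡ termOn (pos x) t -ℤ termOn (neg x) t
termCoef≡termOn-pos-neg x (w , pos y) with x ℕₚ.≟ y
... | yes refl =
  sym (trans (cong₂ _-ℤ_ (termOn-≡ (pos x) w) (termOn-≢ (neg x) (pos x) w λ ())) (ℤₚ.+-identityʳ w))
... | no x≢y =
  sym (cong₂ _-ℤ_ (termOn-≢ (pos x) (pos y) w λ { refl → x≢y refl }) (termOn-≢ (neg x) (pos y) w λ ()))
termCoef≡termOn-pos-neg x (w , neg y) with x ℕₚ.≟ y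
... | yes refl =
  sym (trans (cong₂ _-ℤ_ (termOn-≢ (pos x) (neg x) w λ ()) (termOn-≡ (neg x) w)) (ℤₚ.+-identityˡ (- w)))
... | no x≢y =
  sym (cong₂ _-ℤ_ (termOn-≢ (pos x) (neg y) w λ ()) (termOn-≢ (neg x) (neg y) w λ { refl → x≢y refl }))

coef≡litCoef-pos-neg : ∀ C x → coef C x ≡ litCoef C (pos x) -ℤ litCoef C (neg x)
coef≡litCoef-pos-neg C x =
  trans (Σℤ-cong (terms C) (λ {t} _ → termCoef≡termOn-pos-neg x t)) (Σℤ-- (terms C) _ _)

isNeg : Lit → ℤ
isNeg (pos _) = + 0
isNeg (neg _) = + 1

Σ-negShift : ∀ {H} → Unique H → ∀ T → (∀ {t} → t ∈ T → proj₂ t ∈ H) →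
             Σℤ T negShift ≡ Σℤ H (λ h → isNeg h *ℤ Σℤ T (termOn h))
Σ-negShift {H} unique [] _ = sym (Σℤ-zero H (λ {h} _ → ℤₚ.*-zeroʳ (isNeg h)))
Σ-negShift {H} unique ((w , n) ∷ T) T⊆H = sym (begin
  Σℤ H (λ h → isNeg h *ℤ (termOn h (w , n) +ℤ Σℤ T (termOn h)))
    ≡⟨ Σℤ-cong H (λ {h} _ → ℤₚ.*-distribˡ-+ (isNeg h) _ _) ⟩
  Σℤ H (λ h → isNeg h *ℤ termOn h (w , n) +ℤ isNeg h *ℤ Σℤ T (termOn h))
    ≡⟨ Σℤ-+ H _ _ ⟩
  Σℤ H (λ h → isNeg h *ℤ termOn h (w , n)) +ℤ Σℤ H (λ h → isNeg h *ℤ Σℤ T (termOn h))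
    ≡⟨ cong₂ _+ℤ_ head (sym (Σ-negShift unique T (T⊆H ∘ there))) ⟩
  negShift (w , n) +ℤ Σℤ T negShift ∎)
  where
  open ≡-Reasoning
  head : Σℤ H (λ h → isNeg h *ℤ termOn h (w , n)) ≡ negShift (w , n)
  head = trans (Σℤ-delta _ unique (T⊆H (here refl))
                 (λ {h} h≢n → trans (cong (isNeg h *ℤ_) (termOn-≢ h n w (h≢n ∘ sym))) (ℤₚ.*-zeroʳ (isNeg h))))
               (trans (cong (isNeg n *ℤ_) (termOn-≡ n w)) (isNeg*≡negShift n))
    where
    isNeg*≡negShift : ∀ n → isNeg n *ℤ w ≡ negShift (w , n)
    isNeg*≡negShift (pos _) = refl
    isNeg*≡negShift (neg _) = ℤₚ.*-identityˡ w

≈-byLitCoef : ∀ C D → (∀ m → litCoef C m ≡ litCoef D m) → rhs C ≡ rhs D → C ≈ D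
≈-byLitCoef C D litCoef≡ rhs≡ =
  (λ x → trans (coef≡litCoef-pos-neg C x)
               (trans (cong₂ _-ℤ_ (litCoef≡ (pos x)) (litCoef≡ (neg x))) (sym (coef≡litCoef-pos-neg D x))))
  , cong₂ _-ℤ_ rhs≡ (begin
      Σℤ (terms C) negShift
        ≡⟨ Σ-negShift unique (terms C) (λ t∈C → inH (∈-++⁺ˡ t∈C)) ⟩
      Σℤ H (λ h → isNeg h *ℤ litCoef C h)
        ≡⟨ Σℤ-cong H (λ {h} _ → cong (isNeg h *ℤ_) (litCoef≡ h)) ⟩
      Σℤ H (λ h → isNeg h *ℤ litCoef D h)
        ≡⟨ Σ-negShift unique (terms D) (λ t∈D → inH (∈-++⁺ʳ (terms C) t∈D)) ⟨
      Σℤ (terms D) negShift ∎)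
  where
  open ≡-Reasoning
  H : List Lit
  H = deduplicate _≟L_ (map proj₂ (terms C ++ terms D))
  unique : Unique H
  unique = deduplicate-! _≟L_ _
  inH : ∀ {t} → t ∈ terms C ++ terms D → proj₂ t ∈ H
  inH t∈ = ∈-deduplicate⁺ _≟L_ (∈-map⁺ proj₂ t∈)

-- e·ℓ + e·ℓ̄ ≥ e normalises to 0 ≥ 0.
addPair : ℤ → Lit → PB → PB
addPair e ℓ C = pb (terms C ++ (e , ℓ) ∷ (e , ~ ℓ) ∷ []) (rhs C +ℤ e)

addPair-≈ : ∀ e ℓ C → addPair e ℓ C ≈ C
addPair-≈ e ℓ C =
  (λ x → trans (Σℤ-++ (terms C) _ (termCoef x)) (trans (cong (coef C x +ℤ_) (pairCoef x ℓ)) (ℤₚ.+-identityʳ _)))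
  , trans (cong (rhs C +ℤ e -ℤ_)
                (trans (Σℤ-++ (terms C) _ negShift) (cong (Σℤ (terms C) negShift +ℤ_) (pairShift ℓ))))
          (cancel (rhs C) e _)
  where
  pairCoef : ∀ x ℓ → Σℤ ((e , ℓ) ∷ (e , ~ ℓ) ∷ []) (termCoef x) ≡ + 0
  pairCoef x (pos y) with ⌊ x ℕₚ.≟ y ⌋
  ... | true = trans (cong (e +ℤ_) (ℤₚ.+-identityʳ (- e))) (ℤₚ.+-inverseʳ e)
  ... | false = refl
  pairCoef x (neg y) with ⌊ x ℕₚ.≟ y ⌋
  ... | true = trans (cong (- e +ℤ_) (ℤₚ.+-identityʳ e)) (ℤₚ.+-inverseˡ e)
  ... | false = refl
  pairShift : ∀ ℓ → Σℤ ((e , ℓ) ∷ (e , ~ ℓ) ∷ []) negShift ≡ e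
  pairShift (pos _) = trans (ℤₚ.+-identityˡ _) (ℤₚ.+-identityʳ e)
  pairShift (neg _) = ℤₚ.+-identityʳ e
  cancel : ∀ a e s → a +ℤ e -ℤ (s +ℤ e) ≡ a -ℤ s
  cancel = ℤ-Ring.solve-∀

VarInjective : List Lit → Set
VarInjective L = ∀ {m n} → m ∈ L → n ∈ L → var m ≡ var n → m ≡ n

ceilDiv-small : ∀ a k → 1 ≤ a → a ≤ suc k → ceilDiv (+ a) k ≡ + 1
ceilDiv-small (suc a) k (s≤s _) (s≤s a≤k) = cong +_ (begin
  (suc a + k) / suc k        ≡⟨ m/n≡1+[m∸n]/n (s≤s (ℕₚ.m≤n+m k a)) ⟩
  suc ((a + k ∸ k) / suc k)  ≡⟨ cong (λ x → suc (x / suc k)) (ℕₚ.m+n∸n≡m a k) ⟩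
  suc (a / suc k)            ≡⟨ cong suc (m<n⇒m/n≡0 (s≤s a≤k)) ⟩
  1                          ∎)
  where open ≡-Reasoning

dividePB-weightedSum : ∀ G H k r → (∀ {m} → m ∈ H → 1 ≤ G m × G m ≤ suc k) → 1 ≤ r → r ≤ suc k →
                       dividePB k (weightedSum G H (+ r)) ≡ weightedSum (λ _ → 1) H (+ 1)
dividePB-weightedSum G H k r G-bounds 1≤r r≤ =
  cong₂ pb (divideTerms H G-bounds) (ceilDiv-small r k 1≤r r≤)
  where
  divideTerms : ∀ H → (∀ {m} → m ∈ H → 1 ≤ G m × G m ≤ suc k) →
                map (λ t → (ceilDiv (proj₁ t) k , proj₂ t)) (terms (weightedSum G H (+ r)))
                ≡ terms (weightedSum (λ _ → 1) H (+ 1))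
  divideTerms [] _ = refl
  divideTerms (m ∷ H) bounds =
    cong₂ _∷_ (cong (_, m) (ceilDiv-small (G m) k (proj₁ (bounds (here refl))) (proj₂ (bounds (here refl)))))
              (divideTerms H (bounds ∘ there))

weightedSum-normalized : ∀ G {H} z → Unique H → VarInjective H →
                         IsNormalized (weightedSum G H z)
weightedSum-normalized G {H} z unique var-injective = nonneg H , distinctVars H unique var-injective
  where
  nonneg : ∀ H → All (λ t → + 0 ≤ℤ proj₁ t) (terms (weightedSum G H z))
  nonneg [] = []
  nonneg (_ ∷ H) = +≤+ z≤n ∷ nonneg H
  distinctVars : ∀ H → Unique H → VarInjective H →
                 Unique (map (λ t → var (proj₂ t)) (terms (weightedSum G H z)))
  distinctVars [] _ _ = []
  distinctVars (m ∷ H) (m∉H ∷ unique) inj =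
    Allₚ.map⁺ (Allₚ.map⁺ (All.tabulate λ n∈H vm≡vn → All.lookup m∉H n∈H (inj (here refl) (there n∈H) vm≡vn)))
    ∷ distinctVars H unique (λ m∈ n∈ → inj (there m∈) (there n∈))

positive : ∀ {z} → + 1 ≤ℤ z → Σ ℕ λ r → z ≡ + r × 1 ≤ r
positive (+≤+ 1≤r) = _ , refl , 1≤r

-- Building derivations

-- Steps to multiply a constraint by k + 1, to add k + 1 copies of a derived one,
-- and to add k copies of a literal axiom.
scaleCost addCost axiomCost : ℕ → ℕ
scaleCost zero = 0
scaleCost (suc _) = 1
addCost k = suc (scaleCost k)
axiomCost zero = 0
axiomCost (suc k) = suc (addCost k)

module Derivations (P : List PB) where

  ∈-snoc : ∀ {C} ss s → C ∈ P ++ ss → C ∈ P ++ (ss ++ [ s ])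
  ∈-snoc {C} ss s C∈ = subst (C ∈_) (++-assoc P ss [ s ]) (∈-++⁺ˡ C∈)

  ∈-last : ∀ ss s → s ∈ P ++ (ss ++ [ s ])
  ∈-last ss s = subst (s ∈_) (++-assoc P ss [ s ]) (∈-++⁺ʳ (P ++ ss) (here refl))

  length-snoc≤ : ∀ {n} (ss : List PB) s → length ss ≤ n → length (ss ++ [ s ]) ≤ suc n
  length-snoc≤ ss s len≤ =
    ℕₚ.≤-trans (ℕₚ.≤-reflexive (trans (length-++ ss {[ s ]}) (ℕₚ.+-comm (length ss) 1))) (s≤s len≤)

  record Reaches (n : ℕ) (f : Lit → ℤ) (r : ℤ) : Set where
    constructor reaches
    field
      steps : List PB
      derivation : Derivation P steps
      length≤ : length steps ≤ n
      result : PB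
      result∈ : result ∈ P ++ steps
      litCoef-result : ∀ m → litCoef result m ≡ f m
      rhs-result : rhs result ≡ r
  open Reaches

  Reaches-resp : ∀ {n n′ f f′ r r′} → n ≤ n′ → (∀ m → f m ≡ f′ m) → r ≡ r′ → Reaches n f r → Reaches n′ f′ r′
  Reaches-resp n≤n′ f≡f′ r≡r′ (reaches ss d len C C∈ coef≡ rhs≡) =
    reaches ss d (ℕₚ.≤-trans len n≤n′) C C∈ (λ m → trans (coef≡ m) (f≡f′ m)) (trans rhs≡ r≡r′)

  premise : ∀ {C} → C ∈ P → Reaches 0 (litCoef C) (rhs C)
  premise {C} C∈P = reaches [] done z≤n C (∈-++⁺ˡ C∈P) (λ _ → refl) refl

  keepResult : ∀ {n f r s} (R : Reaches n f r) → Justified (P ++ steps R) s → Reaches (suc n) f r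
  keepResult {s = s} (reaches ss d len C C∈ coef≡ rhs≡) j =
    reaches (ss ++ [ s ]) (step d j) (length-snoc≤ ss s len) C (∈-snoc ss s C∈) coef≡ rhs≡

  newResult : ∀ {n f r} s (R : Reaches n f r) → Justified (P ++ steps R) s → Reaches (suc n) (litCoef s) (rhs s)
  newResult s (reaches ss d len _ _ _ _) j =
    reaches (ss ++ [ s ]) (step d j) (length-snoc≤ ss s len) s (∈-last ss s) (λ _ → refl) refl

  scaledPremise : ∀ {C} → C ∈ P → (k : ℕ) →
                  Reaches (scaleCost k) (λ m → + suc k *ℤ litCoef C m) (+ suc k *ℤ rhs C)
  scaledPremise C∈P zero = Reaches-resp z≤n (λ _ → sym (ℤₚ.*-identityˡ _)) (sym (ℤₚ.*-identityˡ _)) (premise C∈P)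
  scaledPremise {C} C∈P (suc k) =
    Reaches-resp ℕₚ.≤-refl (litCoef-scalePB (suc k) C) refl
      (newResult (scalePB (suc k) C) (premise C∈P) (multiply C (∈-++⁺ˡ C∈P) (suc k) (≈-refl {scalePB (suc k) C})))

  Adds : ℕ → (Lit → ℤ) → ℤ → Set
  Adds n δ ρ = ∀ {n₀ f r} → Reaches n₀ f r → Reaches (n₀ + n) (λ m → f m +ℤ δ m) (r +ℤ ρ)

  addNothing : Adds 0 (λ _ → + 0) (+ 0)
  addNothing = Reaches-resp (ℕₚ.≤-reflexive (sym (ℕₚ.+-identityʳ _)))
                 (λ _ → sym (ℤₚ.+-identityʳ _)) (sym (ℤₚ.+-identityʳ _))

  _⨾_ : ∀ {n n′ δ δ′ ρ ρ′} → Adds n δ ρ → Adds n′ δ′ ρ′ → Adds (n + n′) (λ m → δ m +ℤ δ′ m) (ρ +ℤ ρ′)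
  (add ⨾ add′) {n₀} {f} {r} R = Reaches-resp (ℕₚ.≤-reflexive (ℕₚ.+-assoc n₀ _ _))
                                  (λ m → ℤₚ.+-assoc (f m) _ _) (ℤₚ.+-assoc r _ _) (add′ (add R))

  addAll : ∀ {A : Set} (xs : List A) {n : A → ℕ} {δ : A → Lit → ℤ} {ρ : A → ℤ} →
           (∀ {x} → x ∈ xs → Adds (n x) (δ x) (ρ x)) →
           Adds (Σℕ xs n) (λ m → Σℤ xs (λ x → δ x m)) (Σℤ xs ρ)
  addAll [] _ = addNothing
  addAll (x ∷ xs) add = add (here refl) ⨾ addAll xs (add ∘ there)

  addMultipleAt : ∀ {n₀ f r X} (R : Reaches n₀ f r) → X ∈ P ++ steps R → (k : ℕ) →
                  Reaches (n₀ + addCost k) (λ m → f m +ℤ + suc k *ℤ litCoef X m) (r +ℤ + suc k *ℤ rhs X)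
  addMultipleAt {n₀} {X = X} R X∈ zero =
    Reaches-resp (ℕₚ.≤-reflexive (ℕₚ.+-comm 1 n₀))
      (λ m → trans (litCoef-addPB C X m) (cong₂ _+ℤ_ (litCoef-result R m) (sym (ℤₚ.*-identityˡ _))))
      (cong₂ _+ℤ_ (rhs-result R) (sym (ℤₚ.*-identityˡ _)))
      (newResult (addPB C X) R (addition C X (result∈ R) X∈ (≈-refl {addPB C X})))
    where
    C : PB
    C = result R
  addMultipleAt {n₀} {f} {r} {X} R X∈ (suc k) =
    Reaches-resp (ℕₚ.≤-reflexive (ℕₚ.+-comm 2 n₀))
      (λ m → trans (litCoef-addPB C X′ m) (cong₂ _+ℤ_ (litCoef-result R m) (litCoef-scalePB (suc k) X m)))
      (cong (_+ℤ rhs X′) (rhs-result R))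
      (newResult (addPB C X′) R′ (addition C X′ (result∈ R′) (∈-last (steps R) X′) (≈-refl {addPB C X′})))
    where
    C X′ : PB
    C = result R
    X′ = scalePB (suc k) X
    R′ : Reaches (suc n₀) f r
    R′ = keepResult R (multiply X X∈ (suc k) (≈-refl {X′}))

  addMultipleOfPremise : ∀ {X} → X ∈ P → (k : ℕ) →
                         Adds (addCost k) (λ m → + suc k *ℤ litCoef X m) (+ suc k *ℤ rhs X)
  addMultipleOfPremise X∈P k R = addMultipleAt R (∈-++⁺ˡ X∈P) k

  addMultipleOfAxiom : ∀ ℓ (k : ℕ) → Adds (axiomCost k) (λ m → + k *ℤ litCoef (axiomPB ℓ) m) (+ 0)
  addMultipleOfAxiom ℓ zero {n₀} {f} {r} =
    Reaches-resp (ℕₚ.≤-reflexive (sym (ℕₚ.+-identityʳ n₀)))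
      (λ m → sym (trans (cong (f m +ℤ_) (ℤₚ.*-zeroˡ (litCoef (axiomPB ℓ) m))) (ℤₚ.+-identityʳ (f m))))
      (sym (ℤₚ.+-identityʳ r))
  addMultipleOfAxiom ℓ (suc k) {n₀} {f} {r} R =
    Reaches-resp (ℕₚ.≤-reflexive (sym (ℕₚ.+-suc n₀ _))) (λ _ → refl) (cong (r +ℤ_) (ℤₚ.*-zeroʳ (+ suc k)))
      (addMultipleAt R′ (∈-last (steps R) (axiomPB ℓ)) k)
    where
    R′ : Reaches (suc n₀) f r
    R′ = keepResult R (axiom ℓ (≈-refl {axiomPB ℓ}))

  clauseByDivision : ∀ {n f r} (R : Reaches n f r) (L : List Lit) (G : Lit → ℕ) (M : ℕ) →
    (∀ {m} → m ∈ L → 1 ≤ G m × G m ≤ M) → VarInjective L →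
    (C : PB) → C ≈ result R → (∀ m → litCoef C m ≡ + G m) → (∀ {m} → m ∉ L → G m ≡ 0) → + 1 ≤ℤ rhs C →
    Derives P (clausePB L) (suc n)
  clauseByDivision R L G M G-bounds var-injective C C≈R litCoef-C G-∉ 1≤rhs with positive 1≤rhs
  ... | r , rhs≡ , 1≤r =
    steps R ++ [ clausePB L ] ,
    step (derivation R) division-step ,
    length-snoc≤ (steps R) (clausePB L) (length≤ R) ,
    Any.map (λ { refl → ≈-refl {clausePB L} }) (∈-last (steps R) (clausePB L))
    where
    H : List Lit
    H = deduplicate _≟L_ L
    N : PB
    N = weightedSum G H (+ r)
    N≈C : N ≈ C
    N≈C = ≈-byLitCoef N C (λ m → trans (litCoef-N m) (sym (litCoef-C m))) (sym rhs≡)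
      where
      litCoef-N : ∀ m → litCoef N m ≡ + G m
      litCoef-N m with m ∈? L
      ... | yes m∈L = litCoef-weightedSum-∈ G (+ r) (deduplicate-! _≟L_ L) (∈-deduplicate⁺ _≟L_ m∈L)
      ... | no m∉L = trans (litCoef-weightedSum-∉ G (+ r) (m∉L ∘ ∈-deduplicate⁻ _≟L_ L)) (cong +_ (sym (G-∉ m∉L)))
    -- dividing by r + M + 1 rounds every coefficient and the degree up to 1
    divided : dividePB (r + M) N ≡ clausePB L
    divided = dividePB-weightedSum G H (r + M) r
      (λ m∈H → let (1≤G , G≤M) = G-bounds (∈-deduplicate⁻ _≟L_ L m∈H)
               in 1≤G , ℕₚ.≤-trans G≤M (ℕₚ.≤-trans (ℕₚ.m≤n+m M r) (ℕₚ.n≤1+n _)))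
      1≤r (ℕₚ.≤-trans (ℕₚ.m≤m+n r M) (ℕₚ.n≤1+n _))
    division-step : Justified (P ++ steps R) (clausePB L)
    division-step =
      division (result R) N (result∈ R) (≈-trans {N} {C} {result R} N≈C C≈R)
        (weightedSum-normalized G (+ r) (deduplicate-! _≟L_ L)
          (λ m∈ n∈ → var-injective (∈-deduplicate⁻ _≟L_ L m∈) (∈-deduplicate⁻ _≟L_ L n∈)))
        (+≤+ z≤n) (r + M) (subst (_≈ dividePB (r + M) N) divided (≈-refl {dividePB (r + M) N}))

Derives-weaken : ∀ {P T n n′} → n ≤ n′ → Derives P T n → Derives P T n′
Derives-weaken n≤n′ (ss , d , len , found) = ss , d , ℕₚ.≤-trans len n≤n′ , found

-+-cancel : ∀ c x y g h → x + y + h ≡ g + c → - + c +ℤ + x +ℤ + y ≡ + g -ℤ + h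
-+-cancel c x y g h x+y+h≡g+c = begin
  - + c +ℤ + x +ℤ + y             ≡⟨ rearrange (+ c) (+ x) (+ y) (+ h) ⟩
  - + c +ℤ (+ x +ℤ + y +ℤ + h) -ℤ + h ≡⟨ cong (λ z → - + c +ℤ z -ℤ + h) (sym (ℤₚ.pos-+ (x + y) h)) ⟩
  - + c +ℤ + (x + y + h) -ℤ + h   ≡⟨ cong (λ z → - + c +ℤ + z -ℤ + h) x+y+h≡g+c ⟩
  - + c +ℤ + (g + c) -ℤ + h       ≡⟨ cong (λ z → - + c +ℤ z -ℤ + h) (ℤₚ.pos-+ g c) ⟩
  - + c +ℤ (+ g +ℤ + c) -ℤ + h    ≡⟨ cancel (+ c) (+ g) (+ h) ⟩
  + g -ℤ + h                      ∎
  where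
  open ≡-Reasoning
  rearrange : ∀ c x y h → - c +ℤ x +ℤ y ≡ - c +ℤ (x +ℤ y +ℤ h) -ℤ h
  rearrange = ℤ-Ring.solve-∀
  cancel : ∀ c g h → - c +ℤ (g +ℤ c) -ℤ h ≡ g -ℤ h
  cancel = ℤ-Ring.solve-∀

-- μ(1 - v) + X = μ(1 + Y - Z - v) ≥ μ.
degree-positive : ∀ μ X Y Z v → 1 ≤ μ → X + μ * Z ≡ μ * Y → v ≤ℤ + Y -ℤ + Z →
                  + 1 ≤ℤ + μ *ℤ - (v -ℤ + 1) +ℤ + X
degree-positive μ X Y Z v 1≤μ X+μZ≡μY v≤Y-Z =
  subst (+ 1 ≤ℤ_) (sym degree≡) (+≤+ (ℕₚ.*-mono-≤ 1≤μ (s≤s z≤n)))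
  where
  gap : ℕ
  gap = ∣ + Y -ℤ + Z -ℤ v ∣
  gap≡ : + gap ≡ + Y -ℤ + Z -ℤ v
  gap≡ = ℤₚ.0≤i⇒+∣i∣≡i (ℤₚ.i≤j⇒0≤j-i v≤Y-Z)
  X≡ : + X ≡ + μ *ℤ + Y -ℤ + μ *ℤ + Z
  X≡ = begin
    + X                                 ≡⟨ add-sub (+ X) (+ μ *ℤ + Z) ⟩
    + X +ℤ + μ *ℤ + Z -ℤ + μ *ℤ + Z     ≡⟨ cong (λ z → + X +ℤ z -ℤ + μ *ℤ + Z) (ℤₚ.pos-* μ Z) ⟨
    + X +ℤ + (μ * Z) -ℤ + μ *ℤ + Z      ≡⟨ cong (λ z → z -ℤ + μ *ℤ + Z) (ℤₚ.pos-+ X (μ * Z)) ⟨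
    + (X + μ * Z) -ℤ + μ *ℤ + Z         ≡⟨ cong (λ z → + z -ℤ + μ *ℤ + Z) X+μZ≡μY ⟩
    + (μ * Y) -ℤ + μ *ℤ + Z             ≡⟨ cong (λ z → z -ℤ + μ *ℤ + Z) (ℤₚ.pos-* μ Y) ⟩
    + μ *ℤ + Y -ℤ + μ *ℤ + Z            ∎
    where
    open ≡-Reasoning
    add-sub : ∀ a b → a ≡ a +ℤ b -ℤ b
    add-sub = ℤ-Ring.solve-∀
  degree≡ : + μ *ℤ - (v -ℤ + 1) +ℤ + X ≡ + (μ * suc gap)
  degree≡ = begin
    + μ *ℤ - (v -ℤ + 1) +ℤ + X                             ≡⟨ cong (+ μ *ℤ - (v -ℤ + 1) +ℤ_) X≡ ⟩
    + μ *ℤ - (v -ℤ + 1) +ℤ (+ μ *ℤ + Y -ℤ + μ *ℤ + Z)      ≡⟨ factor (+ μ) (+ Y) (+ Z) v ⟩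
    + μ *ℤ (+ 1 +ℤ (+ Y -ℤ + Z -ℤ v))                      ≡⟨ cong (λ z → + μ *ℤ (+ 1 +ℤ z)) gap≡ ⟨
    + μ *ℤ + suc gap                                       ≡⟨ ℤₚ.pos-* μ (suc gap) ⟨
    + (μ * suc gap)                                        ∎
    where
    open ≡-Reasoning
    factor : ∀ m y z v → m *ℤ (- (v -ℤ + 1)) +ℤ (m *ℤ y -ℤ m *ℤ z) ≡ m *ℤ (+ 1 +ℤ (y -ℤ z -ℤ v))
    factor = ℤ-Ring.solve-∀

-- Cores and the two derivations

consistent-∷ : ∀ {α ℓ} → Consistent α → ~ ℓ ∉ α → Consistent (ℓ ∷ α)
consistent-∷ cons ~ℓ∉α x (here refl) (here ())
consistent-∷ cons ~ℓ∉α x (here refl) (there neg∈α) = ~ℓ∉α neg∈α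
consistent-∷ cons ~ℓ∉α x (there pos∈α) (here refl) = ~ℓ∉α pos∈α
consistent-∷ cons ~ℓ∉α x (there pos∈α) (there neg∈α) = cons x pos∈α neg∈α

negations-varInjective : ∀ {α L} → Consistent α → (∀ {m} → m ∈ L → ~ m ∈ α) → VarInjective L
negations-varInjective cons ~L⊆α {m} {n} m∈L n∈L vm≡vn with sameVar⇒≡⊎~ m n vm≡vn
... | inj₁ m≡n = m≡n
... | inj₂ refl = ⊥-elim (consistent-~ cons (~ m) (~L⊆α m∈L) (~L⊆α n∈L))

inR inK inKonly : Core → Lit → ℕ
inR q m = 𝟙 ⌊ ~ m ∈? R q ⌋
inK q m = 𝟙 ⌊ ~ m ∈? K q ⌋
inKonly q m = if ⌊ ~ m ∈? R q ⌋ then 0 else inK q m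

litCoef-coreClause : ∀ q m → litCoef (coreClause q) m ≡ + (inR q m + inKonly q m)
litCoef-coreClause q m =
  trans (litCoef-clausePB _ m) (cong +_ (split (m ∈? map ~_ (R q ++ K q)) (~ m ∈? R q) (~ m ∈? K q)))
  where
  split : (m∈? : Dec (m ∈ map ~_ (R q ++ K q))) (∈R? : Dec (~ m ∈ R q)) (∈K? : Dec (~ m ∈ K q)) →
          𝟙 ⌊ m∈? ⌋ ≡ 𝟙 ⌊ ∈R? ⌋ + (if ⌊ ∈R? ⌋ then 0 else 𝟙 ⌊ ∈K? ⌋)
  split (yes _) (yes _) _ = refl
  split (yes _) (no _) (yes _) = refl
  split (yes m∈) (no ∉R) (no ∉K) with ∈-++⁻ (R q) (∈-map-~⁻ m∈)
  ... | inj₁ ∈R = ⊥-elim (∉R ∈R)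
  ... | inj₂ ∈K = ⊥-elim (∉K ∈K)
  split (no m∉) (yes ∈R) _ = ⊥-elim (m∉ (∈-map-~⁺ (∈-++⁺ˡ ∈R)))
  split (no m∉) (no _) (yes ∈K) = ⊥-elim (m∉ (∈-map-~⁺ (∈-++⁺ʳ (R q) ∈K)))
  split (no _) (no _) (no _) = refl

inKonly≤inK : ∀ q m → inKonly q m ≤ inK q m
inKonly≤inK q m with ⌊ ~ m ∈? R q ⌋
... | true = z≤n
... | false = ℕₚ.≤-refl

coreSetLits⁻ : ∀ 𝒞 {m} → m ∈ coreSetLits 𝒞 → Σ Core λ q → q ∈ 𝒞 × ~ m ∈ R q
coreSetLits⁻ (q ∷ 𝒞) m∈ with ∈-++⁻ (map ~_ (R q)) m∈
... | inj₁ m∈q = q , here refl , ∈-map-~⁻ m∈q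
... | inj₂ m∈𝒞 with coreSetLits⁻ 𝒞 m∈𝒞
...   | q′ , q′∈𝒞 , ~m∈R = q′ , there q′∈𝒞 , ~m∈R

coreSetLits⁺ : ∀ 𝒞 {m q} → q ∈ 𝒞 → ~ m ∈ R q → m ∈ coreSetLits 𝒞
coreSetLits⁺ (q ∷ 𝒞) (here refl) ~m∈R = ∈-++⁺ˡ (∈-map-~⁺ ~m∈R)
coreSetLits⁺ (q ∷ 𝒞) (there q∈𝒞) ~m∈R = ∈-++⁺ʳ (map ~_ (R q)) (coreSetLits⁺ 𝒞 q∈𝒞 ~m∈R)

addCost≤2 : ∀ k → addCost k ≤ 2
addCost≤2 zero = s≤s z≤n
addCost≤2 (suc _) = ℕₚ.≤-refl

axiomCost≤3 : ∀ k → axiomCost k ≤ 3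
axiomCost≤3 zero = z≤n
axiomCost≤3 (suc k) = s≤s (addCost≤2 k)

module Construction (I : MaxSAT) (α : List Lit) (v : ℤ) (𝒞 : List Core) (cores : All (IsCore I α) 𝒞) where
  open Derivations (premises I v 𝒞)

  wt-pos : ∀ {q} → q ∈ 𝒞 → 0 < wt q
  wt-pos q∈𝒞 = proj₁ (All.lookup cores q∈𝒞)

  R⊆α : ∀ {q m} → q ∈ 𝒞 → m ∈ R q → m ∈ α
  R⊆α q∈𝒞 = All.lookup (proj₁ (proj₂ (proj₂ (All.lookup cores q∈𝒞))))

  K⊆~obj : ∀ {q m} → q ∈ 𝒞 → ~ m ∈ K q → m ∈ objLits I
  K⊆~obj {m = m} q∈𝒞 ~m∈K with All.lookup (proj₁ (proj₂ (proj₂ (proj₂ (proj₂ (All.lookup cores q∈𝒞)))))) ~m∈K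
  ... | b , b∈O , ~m≡~b = subst (_∈ objLits I) (~-injective (sym ~m≡~b)) b∈O
    where
    ~-injective : ∀ {b m} → ~ b ≡ ~ m → b ≡ m
    ~-injective {b} {m} eq = trans (sym (~-involutive b)) (trans (cong ~_ eq) (~-involutive m))

  coreSetLits⊆~α : ∀ {m} → m ∈ coreSetLits 𝒞 → ~ m ∈ α
  coreSetLits⊆~α m∈ with coreSetLits⁻ 𝒞 m∈
  ... | q , q∈𝒞 , ~m∈R = R⊆α q∈𝒞 ~m∈R

  objCount : Lit → ℕ
  objCount m = Σℕ (O I) (λ t → 𝟙 ⌊ proj₂ t ≟L m ⌋)

  objCount-∉ : ∀ {m} → m ∉ objLits I → objCount m ≡ 0
  objCount-∉ {m} m∉ =
    Σℕ-zero (O I) (λ t∈O → cong 𝟙 (isYes-false (_ ≟L m) (λ { refl → m∉ (∈-map⁺ proj₂ t∈O) })))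

  objCount-∈ : ∀ {m} → m ∈ objLits I → objCount m ≡ 1
  objCount-∈ {m} = count (O I) (distinct I)
    where
    count : ∀ ts → Unique (map proj₂ ts) → m ∈ map proj₂ ts → Σℕ ts (λ t → 𝟙 ⌊ proj₂ t ≟L m ⌋) ≡ 1
    count (t ∷ ts) (t∉ts ∷ _) (here refl) =
      cong₂ _+_ (cong 𝟙 (isYes-true (m ≟L m) refl))
        (Σℕ-zero ts (λ t′∈ts → cong 𝟙 (isYes-false (_ ≟L m)
          (λ { refl → All.lookup t∉ts (∈-map⁺ proj₂ t′∈ts) refl }))))
    count (t ∷ ts) (t∉ts ∷ unique) (there m∈ts) =
      cong₂ _+_ (cong 𝟙 (isYes-false (proj₂ t ≟L m) (λ { refl → All.lookup t∉ts m∈ts refl })))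
                (count ts unique m∈ts)

  cost-∉ : ∀ {m} → m ∉ objLits I → cost I m ≡ 0
  cost-∉ {m} m∉ =
    Σℕ-zero (O I) (λ {t} t∈O →
      cong (if_then proj₁ t else 0) (isYes-false (_ ≟L m) (λ { refl → m∉ (∈-map⁺ proj₂ t∈O) })))

  cost-pos : ∀ {m} → m ∈ objLits I → 1 ≤ cost I m
  cost-pos m∈ with ∈-map⁻ proj₂ m∈
  ... | (c , m) , t∈O , refl = ℕₚ.≤-trans (All.lookup (costPos I) t∈O)
    (ℕₚ.≤-trans (ℕₚ.≤-reflexive (cong (if_then c else 0) (sym (isYes-true (m ≟L m) refl))))
                (∈⇒≤Σℕ (λ t → if ⌊ proj₂ t ≟L m ⌋ then proj₁ t else 0) t∈O))

  load≡ : ∀ m → load 𝒞 m ≡ Σℕ 𝒞 (λ q → wt q * inK q m)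
  load≡ m = Σℕ-cong 𝒞 (λ {q} _ → if≡*𝟙 ⌊ ~ m ∈? K q ⌋ (wt q))
    where
    if≡*𝟙 : ∀ b w → (if b then w else 0) ≡ w * 𝟙 b
    if≡*𝟙 true w = sym (ℕₚ.*-identityʳ w)
    if≡*𝟙 false w = sym (ℕₚ.*-zeroʳ w)

  coreR coreK : (Core → ℕ) → Lit → ℕ
  coreR κ m = Σℕ 𝒞 (λ q → suc (κ q) * inR q m)
  coreK κ m = Σℕ 𝒞 (λ q → suc (κ q) * inKonly q m)

  coreR-∉ : ∀ κ {m} → m ∉ coreSetLits 𝒞 → coreR κ m ≡ 0
  coreR-∉ κ {m} m∉ = Σℕ-zero 𝒞 (λ {q} q∈𝒞 →
    trans (cong (λ b → suc (κ q) * 𝟙 b) (isYes-false (~ m ∈? R q) (m∉ ∘ coreSetLits⁺ 𝒞 q∈𝒞)))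
          (ℕₚ.*-zeroʳ (suc (κ q))))

  coreR-pos : ∀ κ {m} → m ∈ coreSetLits 𝒞 → 1 ≤ coreR κ m
  coreR-pos κ {m} m∈ with coreSetLits⁻ 𝒞 m∈
  ... | q , q∈𝒞 , ~m∈R = ℕₚ.≤-trans
    (ℕₚ.≤-trans (s≤s z≤n) (ℕₚ.≤-reflexive (cong (λ b → suc (κ q) * 𝟙 b) (sym (isYes-true (~ m ∈? R q) ~m∈R)))))
    (∈⇒≤Σℕ (λ q → suc (κ q) * inR q m) q∈𝒞)

  coreR≤ : ∀ κ m → coreR κ m ≤ Σℕ 𝒞 (suc ∘ κ)
  coreR≤ κ m = Σℕ-mono 𝒞 (λ {q} _ →
    ℕₚ.≤-trans (ℕₚ.*-monoʳ-≤ (suc (κ q)) (𝟙≤1 ⌊ ~ m ∈? R q ⌋)) (ℕₚ.≤-reflexive (ℕₚ.*-identityʳ (suc (κ q)))))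

  coreK-∉ : ∀ κ {m} → m ∉ objLits I → coreK κ m ≡ 0
  coreK-∉ κ {m} m∉ = Σℕ-zero 𝒞 (λ {q} q∈𝒞 →
    trans (cong (suc (κ q) *_) (ℕₚ.n≤0⇒n≡0 (ℕₚ.≤-trans (inKonly≤inK q m)
            (ℕₚ.≤-reflexive (cong 𝟙 (isYes-false (~ m ∈? K q) (m∉ ∘ K⊆~obj q∈𝒞)))))))
          (ℕₚ.*-zeroʳ (suc (κ q))))

  -- μ·(O ≤ v - 1) + Σ_q (κ q + 1)·C_q + Σ_b a(b)·(b ≥ 0)
  combination : ∀ μ′ κ (a : Lit → ℕ) →
    Reaches (scaleCost μ′ + Σℕ 𝒞 (addCost ∘ κ) + Σℕ (O I) (axiomCost ∘ a ∘ proj₂))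
            (λ m → - + (suc μ′ * cost I m) +ℤ + (coreR κ m + coreK κ m) +ℤ + (a m * objCount m))
            (+ suc μ′ *ℤ - (v -ℤ + 1) +ℤ + Σℕ 𝒞 (suc ∘ κ))
  combination μ′ κ a =
    Reaches-resp ℕₚ.≤-refl
      (λ m → cong₂ _+ℤ_ (cong₂ _+ℤ_ (objectivePart m) (corePart m)) (axiomPart m))
      (trans (cong₂ _+ℤ_ (cong (+ μ *ℤ - (v -ℤ + 1) +ℤ_) coreRhs) (Σℤ-zero (O I) (λ _ → refl)))
             (ℤₚ.+-identityʳ _))
      (addAll (O I) (λ {t} _ → addMultipleOfAxiom (proj₂ t) (a (proj₂ t)))
        (addAll 𝒞 (λ {q} q∈𝒞 → addMultipleOfPremise (there (∈-map⁺ coreClause q∈𝒞)) (κ q))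
          (scaledPremise (here refl) μ′)))
    where
    μ : ℕ
    μ = suc μ′
    objectivePart : ∀ m → + μ *ℤ litCoef (objLeq I v) m ≡ - + (μ * cost I m)
    objectivePart m = begin
      + μ *ℤ litCoef (objLeq I v) m  ≡⟨ cong (+ μ *ℤ_) (litCoef-objLeq I v m) ⟩
      + μ *ℤ - + cost I m            ≡⟨ ℤₚ.neg-distribʳ-* (+ μ) (+ cost I m) ⟨
      - (+ μ *ℤ + cost I m)          ≡⟨ cong -_ (ℤₚ.pos-* μ (cost I m)) ⟨
      - + (μ * cost I m)             ∎
      where open ≡-Reasoning
    corePart : ∀ m → Σℤ 𝒞 (λ q → + suc (κ q) *ℤ litCoef (coreClause q) m) ≡ + (coreR κ m + coreK κ m)
    corePart m = begin
      Σℤ 𝒞 (λ q → + suc (κ q) *ℤ litCoef (coreClause q) m)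
        ≡⟨ Σℤ-cong 𝒞 (λ {q} _ → trans (cong (+ suc (κ q) *ℤ_) (litCoef-coreClause q m))
                                      (sym (ℤₚ.pos-* (suc (κ q)) (inR q m + inKonly q m)))) ⟩
      Σℤ 𝒞 (λ q → + (suc (κ q) * (inR q m + inKonly q m)))
        ≡⟨ Σℤ-pos 𝒞 _ ⟩
      + Σℕ 𝒞 (λ q → suc (κ q) * (inR q m + inKonly q m))
        ≡⟨ cong +_ (trans (Σℕ-cong 𝒞 (λ {q} _ → ℕₚ.*-distribˡ-+ (suc (κ q)) (inR q m) (inKonly q m)))
                          (Σℕ-+ 𝒞 _ _)) ⟩
      + (coreR κ m + coreK κ m) ∎
      where open ≡-Reasoning
    axiomPart : ∀ m → Σℤ (O I) (λ t → + a (proj₂ t) *ℤ litCoef (axiomPB (proj₂ t)) m) ≡ + (a m * objCount m)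
    axiomPart m = begin
      Σℤ (O I) (λ t → + a (proj₂ t) *ℤ litCoef (axiomPB (proj₂ t)) m)
        ≡⟨ Σℤ-cong (O I) (λ {t} _ → trans (cong (+ a (proj₂ t) *ℤ_) (litCoef-axiomPB (proj₂ t) m))
                                          (sym (ℤₚ.pos-* (a (proj₂ t)) (𝟙 ⌊ proj₂ t ≟L m ⌋)))) ⟩
      Σℤ (O I) (λ t → + (a (proj₂ t) * 𝟙 ⌊ proj₂ t ≟L m ⌋))
        ≡⟨ Σℤ-pos (O I) _ ⟩
      + Σℕ (O I) (λ t → a (proj₂ t) * 𝟙 ⌊ proj₂ t ≟L m ⌋)
        ≡⟨ cong +_ (trans (Σℕ-cong (O I) (λ {t} _ → only-m (proj₂ t))) (Σℕ-*ˡ (O I) (a m) _)) ⟩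
      + (a m * objCount m) ∎
      where
      open ≡-Reasoning
      only-m : ∀ n → a n * 𝟙 ⌊ n ≟L m ⌋ ≡ a m * 𝟙 ⌊ n ≟L m ⌋
      only-m n with n ≟L m
      ... | yes refl = refl
      ... | no _ = trans (ℕₚ.*-zeroʳ (a n)) (sym (ℕₚ.*-zeroʳ (a m)))
    coreRhs : Σℤ 𝒞 (λ q → + suc (κ q) *ℤ + 1) ≡ + Σℕ 𝒞 (suc ∘ κ)
    coreRhs = trans (Σℤ-cong 𝒞 (λ {q} _ → ℤₚ.*-identityʳ (+ suc (κ q)))) (Σℤ-pos 𝒞 (suc ∘ κ))

  module Balanced (compat : Compatible I 𝒞) (μ′ : ℕ) (κ : Core → ℕ)
                  (κ-bound : ∀ {q} → q ∈ 𝒞 → suc (κ q) ≤ suc μ′ * wt q) where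
    μ : ℕ
    μ = suc μ′

    coreK≤μcost : ∀ {m} → m ∈ objLits I → coreK κ m ≤ μ * cost I m
    coreK≤μcost {m} m∈ = begin
      coreK κ m                          ≤⟨ Σℕ-mono 𝒞 (λ {q} q∈ → ℕₚ.*-mono-≤ (κ-bound q∈) (inKonly≤inK q m)) ⟩
      Σℕ 𝒞 (λ q → μ * wt q * inK q m)   ≡⟨ Σℕ-cong 𝒞 (λ {q} _ → ℕₚ.*-assoc μ (wt q) (inK q m)) ⟩
      Σℕ 𝒞 (λ q → μ * (wt q * inK q m)) ≡⟨ Σℕ-*ˡ 𝒞 μ _ ⟩
      μ * Σℕ 𝒞 (λ q → wt q * inK q m)   ≡⟨ cong (μ *_) (load≡ m) ⟨
      μ * load 𝒞 m                       ≤⟨ ℕₚ.*-monoʳ-≤ μ (compat m m∈) ⟩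
      μ * cost I m                       ∎
      where open ℕₚ.≤-Reasoning

    -- the multiplier of the axiom b ≥ 0 that leaves b with coefficient coreR κ b
    objMultiplier : Lit → ℕ
    objMultiplier m = μ * cost I m ∸ coreK κ m

    balanced : ∀ m a h → (m ∈ objLits I → a + h ≡ objMultiplier m) → (m ∉ objLits I → h ≡ 0) →
               - + (μ * cost I m) +ℤ + (coreR κ m + coreK κ m) +ℤ + (a * objCount m) ≡ + coreR κ m -ℤ + h
    balanced m a h a+h≡ h≡0 = -+-cancel (μ * cost I m) _ _ (coreR κ m) h (balancedℕ (m ∈? objLits I))
      where
      open ≡-Reasoning
      balancedℕ : Dec (m ∈ objLits I) → coreR κ m + coreK κ m + a * objCount m + h ≡ coreR κ m + μ * cost I m
      balancedℕ (yes m∈) = begin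
        coreR κ m + coreK κ m + a * objCount m + h
          ≡⟨ cong (λ n → coreR κ m + coreK κ m + a * n + h) (objCount-∈ m∈) ⟩
        coreR κ m + coreK κ m + a * 1 + h           ≡⟨ regroup (coreR κ m) (coreK κ m) a h ⟩
        coreR κ m + (coreK κ m + (a + h))           ≡⟨ cong (λ n → coreR κ m + (coreK κ m + n)) (a+h≡ m∈) ⟩
        coreR κ m + (coreK κ m + objMultiplier m)   ≡⟨ cong (_+_ (coreR κ m)) (ℕₚ.m+[n∸m]≡n (coreK≤μcost m∈)) ⟩
        coreR κ m + μ * cost I m                    ∎
        where
        regroup : ∀ r k a h → r + k + a * 1 + h ≡ r + (k + (a + h))
        regroup = ℕ-Ring.solve-∀
      balancedℕ (no m∉) = begin
        coreR κ m + coreK κ m + a * objCount m + h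
          ≡⟨ cong₂ (λ k n → coreR κ m + k + a * n + h) (coreK-∉ κ m∉) (objCount-∉ m∉) ⟩
        coreR κ m + 0 + a * 0 + h                   ≡⟨ cong (_+_ (coreR κ m + 0 + a * 0)) (h≡0 m∉) ⟩
        coreR κ m + 0 + a * 0 + 0                   ≡⟨ vanish (coreR κ m) a μ ⟩
        coreR κ m + μ * 0                           ≡⟨ cong (λ c → coreR κ m + μ * c) (cost-∉ m∉) ⟨
        coreR κ m + μ * cost I m                    ∎
        where
        vanish : ∀ r a μ → r + 0 + a * 0 + 0 ≡ r + μ * 0
        vanish = ℕ-Ring.solve-∀

  coreSetClause : Consistent α → Compatible I 𝒞 → v ≤ℤ + weight 𝒞 →
                  Derives (premises I v 𝒞) (clausePB (coreSetLits 𝒞)) (3 * length (O I) + 2 * length 𝒞 + 1)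
  coreSetClause cons compat v≤w =
    Derives-weaken {T = clausePB (coreSetLits 𝒞)} length≤bound
      (clauseByDivision combined (coreSetLits 𝒞) (coreR κ) (Σℕ 𝒞 (suc ∘ κ))
        (λ m∈ → coreR-pos κ m∈ , coreR≤ κ _) (negations-varInjective cons coreSetLits⊆~α)
        (result combined) (≈-refl {result combined}) (litCoef-result combined) (coreR-∉ κ) rhs≥1)
    where
    κ : Core → ℕ
    κ = pred ∘ wt
    suc-κ : ∀ {q} → q ∈ 𝒞 → suc (κ q) ≡ wt q
    suc-κ {q} q∈ = ℕₚ.suc-pred (wt q) {{>-nonZero (wt-pos q∈)}}
    open Balanced compat 0 κ (λ q∈ → ℕₚ.≤-reflexive (trans (suc-κ q∈) (sym (ℕₚ.*-identityˡ _))))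
    open Reaches using (result; litCoef-result; rhs-result)
    combined : Reaches (0 + Σℕ 𝒞 (addCost ∘ κ) + Σℕ (O I) (axiomCost ∘ objMultiplier ∘ proj₂))
                       (λ m → + coreR κ m) (+ 1 *ℤ - (v -ℤ + 1) +ℤ + Σℕ 𝒞 (suc ∘ κ))
    combined = Reaches-resp ℕₚ.≤-refl
      (λ m → trans (balanced m (objMultiplier m) 0 (λ _ → ℕₚ.+-identityʳ _) (λ _ → refl)) (ℤₚ.+-identityʳ _))
      refl (combination 0 κ objMultiplier)
    rhs≥1 : + 1 ≤ℤ rhs (result combined)
    rhs≥1 = subst (+ 1 ≤ℤ_) (sym (rhs-result combined))
      (degree-positive 1 (Σℕ 𝒞 (suc ∘ κ)) (weight 𝒞) 0 v ℕₚ.≤-refl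
        (trans (ℕₚ.+-identityʳ _) (trans (Σℕ-cong 𝒞 suc-κ) (sym (ℕₚ.*-identityˡ _))))
        (subst (v ≤ℤ_) (sym (ℤₚ.+-identityʳ _)) v≤w))
    length≤bound : suc (0 + Σℕ 𝒞 (addCost ∘ κ) + Σℕ (O I) (axiomCost ∘ objMultiplier ∘ proj₂))
                   ≤ 3 * length (O I) + 2 * length 𝒞 + 1
    length≤bound = begin
      suc (Σℕ 𝒞 (addCost ∘ κ) + Σℕ (O I) (axiomCost ∘ objMultiplier ∘ proj₂))
        ≡⟨ ℕₚ.+-comm 1 _ ⟩
      Σℕ 𝒞 (addCost ∘ κ) + Σℕ (O I) (axiomCost ∘ objMultiplier ∘ proj₂) + 1
        ≤⟨ ℕₚ.+-monoˡ-≤ 1 (ℕₚ.+-mono-≤ (Σℕ≤*length 𝒞 (addCost≤2 ∘ κ))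
                                        (Σℕ≤*length (O I) (axiomCost≤3 ∘ objMultiplier ∘ proj₂))) ⟩
      2 * length 𝒞 + 3 * length (O I) + 1
        ≡⟨ cong (_+ 1) (ℕₚ.+-comm (2 * length 𝒞) _) ⟩
      3 * length (O I) + 2 * length 𝒞 + 1 ∎
      where open ℕₚ.≤-Reasoning

  module WithObjectiveLiteral (cons : Consistent α) (compat : Compatible I 𝒞) {ℓ : Lit} (ℓ∈O : ℓ ∈ objLits I)
           (unassigned : Unassigned α ℓ) (v≤ : v ≤ℤ residual I 𝒞 ℓ +ℤ + weight 𝒞) (μ′ : ℕ)
           (μ-bound : ∀ {q} → q ∈ 𝒞 → suc (inK q ℓ) ≤ suc μ′ * wt q)
           (μ-cost : scaleCost μ′ + Σℕ 𝒞 (λ q → addCost (suc μ′ * wt q ∸ suc (inK q ℓ))) ≤ 2 * length 𝒞) where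

    -- Taking core q only μ·w_q − [ℓ̄ ∈ K q] times leaves ℓ with a strictly negative coefficient -e.
    κ : Core → ℕ
    κ q = suc μ′ * wt q ∸ suc (inK q ℓ)

    κ-eq : ∀ {q} → q ∈ 𝒞 → suc (κ q) + inK q ℓ ≡ suc μ′ * wt q
    κ-eq {q} q∈ = trans (sym (ℕₚ.+-suc (κ q) (inK q ℓ))) (ℕₚ.m∸n+n≡m (μ-bound q∈))

    open Balanced compat μ′ κ (λ q∈ → ℕₚ.≤-trans (ℕₚ.m≤m+n _ _) (ℕₚ.≤-reflexive (κ-eq q∈)))
    open Reaches using (result; litCoef-result; rhs-result)

    e : ℕ
    e = objMultiplier ℓ

    eAt : Lit → Lit → ℕ
    eAt x m = if ⌊ x ≟L m ⌋ then e else 0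

    eAt≤e : ∀ x m → eAt x m ≤ e
    eAt≤e x m with ⌊ x ≟L m ⌋
    ... | true = ℕₚ.≤-refl
    ... | false = z≤n

    termOn-eAt : ∀ x m → termOn m (+ e , x) ≡ + eAt x m
    termOn-eAt x m with ⌊ x ≟L m ⌋
    ... | true = refl
    ... | false = refl

    a : Lit → ℕ
    a m = if ⌊ ℓ ≟L m ⌋ then 0 else objMultiplier m

    a+eAtℓ : ∀ m → a m + eAt ℓ m ≡ objMultiplier m
    a+eAtℓ m with ℓ ≟L m
    ... | yes refl = refl
    ... | no _ = ℕₚ.+-identityʳ _

    eAtℓ-∉ : ∀ {m} → m ∉ objLits I → eAt ℓ m ≡ 0
    eAtℓ-∉ {m} m∉ = cong (if_then e else 0) (isYes-false (ℓ ≟L m) λ { refl → m∉ ℓ∈O })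

    n : ℕ
    n = scaleCost μ′ + Σℕ 𝒞 (addCost ∘ κ) + Σℕ (O I) (axiomCost ∘ a ∘ proj₂)

    combined : Reaches n (λ m → + coreR κ m -ℤ + eAt ℓ m) (+ μ *ℤ - (v -ℤ + 1) +ℤ + Σℕ 𝒞 (suc ∘ κ))
    combined = Reaches-resp ℕₚ.≤-refl (λ m → balanced m (a m) (eAt ℓ m) (λ _ → a+eAtℓ m) eAtℓ-∉) refl
                 (combination μ′ κ a)

    flipped : PB
    flipped = addPair (+ e) ℓ (result combined)

    L : List Lit
    L = coreSetLits 𝒞 ++ [ ~ ℓ ]

    G : Lit → ℕ
    G m = coreR κ m + eAt (~ ℓ) m

    litCoef-flipped : ∀ m → litCoef flipped m ≡ + G m
    litCoef-flipped m = begin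
      litCoef flipped m
        ≡⟨ Σℤ-++ (terms (result combined)) _ (termOn m) ⟩
      litCoef (result combined) m +ℤ (termOn m (+ e , ℓ) +ℤ (termOn m (+ e , ~ ℓ) +ℤ + 0))
        ≡⟨ cong₂ (λ x y → x +ℤ (y +ℤ (termOn m (+ e , ~ ℓ) +ℤ + 0))) (litCoef-result combined m) (termOn-eAt ℓ m) ⟩
      + coreR κ m -ℤ + eAt ℓ m +ℤ (+ eAt ℓ m +ℤ (termOn m (+ e , ~ ℓ) +ℤ + 0))
        ≡⟨ cancel (+ coreR κ m) (+ eAt ℓ m) (termOn m (+ e , ~ ℓ)) ⟩
      + coreR κ m +ℤ termOn m (+ e , ~ ℓ)
        ≡⟨ trans (cong (+ coreR κ m +ℤ_) (termOn-eAt (~ ℓ) m)) (sym (ℤₚ.pos-+ (coreR κ m) _)) ⟩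
      + G m ∎
      where
      open ≡-Reasoning
      cancel : ∀ r h t → r -ℤ h +ℤ (h +ℤ (t +ℤ + 0)) ≡ r +ℤ t
      cancel = ℤ-Ring.solve-∀

    G-∉ : ∀ {m} → m ∉ L → G m ≡ 0
    G-∉ {m} m∉L = cong₂ _+_ (coreR-∉ κ (m∉L ∘ ∈-++⁺ˡ))
      (cong (if_then e else 0) (isYes-false ((~ ℓ) ≟L m) λ { refl → m∉L (∈-++⁺ʳ (coreSetLits 𝒞) (here refl)) }))

    nK : ℕ
    nK = Σℕ 𝒞 (λ q → inK q ℓ)

    coreKℓ+nK : coreK κ ℓ + nK ≡ μ * load 𝒞 ℓ
    coreKℓ+nK = begin
      coreK κ ℓ + nK                                ≡⟨ Σℕ-+ 𝒞 _ _ ⟨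
      Σℕ 𝒞 (λ q → suc (κ q) * inKonly q ℓ + inK q ℓ) ≡⟨ Σℕ-cong 𝒞 perCore ⟩
      Σℕ 𝒞 (λ q → μ * (wt q * inK q ℓ))            ≡⟨ Σℕ-*ˡ 𝒞 μ _ ⟩
      μ * Σℕ 𝒞 (λ q → wt q * inK q ℓ)              ≡⟨ cong (μ *_) (load≡ ℓ) ⟨
      μ * load 𝒞 ℓ                                  ∎
      where
      open ≡-Reasoning
      scaled𝟙 : ∀ b s w → s + 𝟙 b ≡ μ * w → s * 𝟙 b + 𝟙 b ≡ μ * (w * 𝟙 b)
      scaled𝟙 true s w s+1≡ =
        trans (cong (_+ 1) (ℕₚ.*-identityʳ s)) (trans s+1≡ (cong (μ *_) (sym (ℕₚ.*-identityʳ w))))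
      scaled𝟙 false s w _ =
        trans (ℕₚ.+-identityʳ (s * 0))
              (trans (ℕₚ.*-zeroʳ s) (sym (trans (cong (μ *_) (ℕₚ.*-zeroʳ w)) (ℕₚ.*-zeroʳ μ))))
      perCore : ∀ {q} → q ∈ 𝒞 → suc (κ q) * inKonly q ℓ + inK q ℓ ≡ μ * (wt q * inK q ℓ)
      perCore {q} q∈ =
        trans (cong (λ b → suc (κ q) * (if b then 0 else inK q ℓ) + inK q ℓ)
                    (isYes-false (~ ℓ ∈? R q) (proj₂ unassigned ∘ R⊆α q∈)))
              (scaled𝟙 ⌊ ~ ℓ ∈? K q ⌋ (suc (κ q)) (wt q) (κ-eq q∈))

    coreKℓ<μcost : coreK κ ℓ < μ * cost I ℓ
    coreKℓ<μcost with nK in nK≡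
    ... | zero = begin-strict
      coreK κ ℓ     ≡⟨ Σℕ-zero 𝒞 (λ {q} q∈ → trans (cong (suc (κ q) *_) (ℕₚ.n≤0⇒n≡0 (ℕₚ.≤-trans (inKonly≤inK q ℓ)
                         (ℕₚ.≤-reflexive (Σℕ≡0⇒≡0 (λ q → inK q ℓ) nK≡ q∈))))) (ℕₚ.*-zeroʳ (suc (κ q)))) ⟩
      0             <⟨ ℕₚ.*-mono-≤ {1} {μ} (s≤s z≤n) (cost-pos ℓ∈O) ⟩
      μ * cost I ℓ  ∎
      where open ℕₚ.≤-Reasoning
    ... | suc k = begin-strict
      coreK κ ℓ          <⟨ ℕₚ.m<m+n (coreK κ ℓ) (s≤s z≤n) ⟩
      coreK κ ℓ + suc k  ≡⟨ cong (_+_ (coreK κ ℓ)) nK≡ ⟨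
      coreK κ ℓ + nK     ≡⟨ coreKℓ+nK ⟩
      μ * load 𝒞 ℓ       ≤⟨ ℕₚ.*-monoʳ-≤ μ (compat ℓ ℓ∈O) ⟩
      μ * cost I ℓ       ∎
      where open ℕₚ.≤-Reasoning

    e-pos : 1 ≤ e
    e-pos = ℕₚ.m<n⇒0<n∸m coreKℓ<μcost

    G-bounds : ∀ {m} → m ∈ L → 1 ≤ G m × G m ≤ Σℕ 𝒞 (suc ∘ κ) + e
    G-bounds {m} m∈L with ∈-++⁻ (coreSetLits 𝒞) m∈L
    ... | inj₁ m∈C = ℕₚ.≤-trans (coreR-pos κ m∈C) (ℕₚ.m≤m+n _ _) , ℕₚ.+-mono-≤ (coreR≤ κ m) (eAt≤e (~ ℓ) m)
    ... | inj₂ (here refl) =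
      ℕₚ.≤-trans e-pos (ℕₚ.≤-trans (ℕₚ.≤-reflexive (cong (if_then e else 0) (sym (isYes-true (m ≟L m) refl))))
                                   (ℕₚ.m≤n+m _ _))
      , ℕₚ.+-mono-≤ (coreR≤ κ m) (eAt≤e (~ ℓ) m)

    L⊆~ℓ∷α : ∀ {m} → m ∈ L → ~ m ∈ ℓ ∷ α
    L⊆~ℓ∷α m∈L with ∈-++⁻ (coreSetLits 𝒞) m∈L
    ... | inj₁ m∈C = there (coreSetLits⊆~α m∈C)
    ... | inj₂ (here refl) = here (~-involutive ℓ)

    rhs-flipped : + 1 ≤ℤ rhs flipped
    rhs-flipped = subst (+ 1 ≤ℤ_) (sym rhs≡)
      (degree-positive μ (Σℕ 𝒞 (suc ∘ κ) + e) (weight 𝒞 + cost I ℓ) (load 𝒞 ℓ) v (s≤s z≤n) degree≡ v≤′)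
      where
      open ≡-Reasoning
      rhs≡ : rhs flipped ≡ + μ *ℤ - (v -ℤ + 1) +ℤ + (Σℕ 𝒞 (suc ∘ κ) + e)
      rhs≡ = trans (cong (_+ℤ + e) (rhs-result combined))
                   (trans (ℤₚ.+-assoc (+ μ *ℤ - (v -ℤ + 1)) (+ Σℕ 𝒞 (suc ∘ κ)) (+ e))
                          (cong (+ μ *ℤ - (v -ℤ + 1) +ℤ_) (sym (ℤₚ.pos-+ (Σℕ 𝒞 (suc ∘ κ)) e))))
      degree≡ : Σℕ 𝒞 (suc ∘ κ) + e + μ * load 𝒞 ℓ ≡ μ * (weight 𝒞 + cost I ℓ)
      degree≡ = begin
        Σℕ 𝒞 (suc ∘ κ) + e + μ * load 𝒞 ℓ                 ≡⟨ cong (_+_ (Σℕ 𝒞 (suc ∘ κ) + e)) coreKℓ+nK ⟨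
        Σℕ 𝒞 (suc ∘ κ) + e + (coreK κ ℓ + nK)             ≡⟨ regroup (Σℕ 𝒞 (suc ∘ κ)) e (coreK κ ℓ) nK ⟩
        (Σℕ 𝒞 (suc ∘ κ) + nK) + (e + coreK κ ℓ)
          ≡⟨ cong₂ _+_ Σsucκ+nK (ℕₚ.m∸n+n≡m (ℕₚ.<⇒≤ coreKℓ<μcost)) ⟩
        μ * weight 𝒞 + μ * cost I ℓ                       ≡⟨ ℕₚ.*-distribˡ-+ μ (weight 𝒞) (cost I ℓ) ⟨
        μ * (weight 𝒞 + cost I ℓ)                         ∎
        where
        regroup : ∀ s e k n → s + e + (k + n) ≡ (s + n) + (e + k)
        regroup = ℕ-Ring.solve-∀
        Σsucκ+nK : Σℕ 𝒞 (suc ∘ κ) + nK ≡ μ * weight 𝒞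
        Σsucκ+nK = trans (sym (Σℕ-+ 𝒞 (suc ∘ κ) (λ q → inK q ℓ))) (trans (Σℕ-cong 𝒞 κ-eq) (Σℕ-*ˡ 𝒞 μ wt))
      v≤′ : v ≤ℤ + (weight 𝒞 + cost I ℓ) -ℤ + load 𝒞 ℓ
      v≤′ = subst (v ≤ℤ_) (trans (reorder (+ cost I ℓ) (+ load 𝒞 ℓ) (+ weight 𝒞))
                                 (cong (_-ℤ + load 𝒞 ℓ) (sym (ℤₚ.pos-+ (weight 𝒞) (cost I ℓ))))) v≤
        where
        reorder : ∀ c l w → c -ℤ l +ℤ w ≡ w +ℤ c -ℤ l
        reorder = ℤ-Ring.solve-∀

    length≤bound : suc n ≤ 3 * length (O I) + 2 * length 𝒞 ∸ 2
    length≤bound = ℕₚ.m+n≤o⇒m≤o∸n (suc n) (begin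
      suc n + 2
        ≡⟨ regroup (scaleCost μ′) (Σℕ 𝒞 (addCost ∘ κ)) (Σℕ (O I) (axiomCost ∘ a ∘ proj₂)) ⟩
      (scaleCost μ′ + Σℕ 𝒞 (addCost ∘ κ)) + (3 + Σℕ (O I) (axiomCost ∘ a ∘ proj₂))
        ≤⟨ ℕₚ.+-mono-≤ μ-cost objectiveSteps ⟩
      2 * length 𝒞 + 3 * length (O I)
        ≡⟨ ℕₚ.+-comm (2 * length 𝒞) _ ⟩
      3 * length (O I) + 2 * length 𝒞 ∎)
      where
      open ℕₚ.≤-Reasoning
      regroup : ∀ s c o → suc (s + c + o) + 2 ≡ (s + c) + (3 + o)
      regroup = ℕ-Ring.solve-∀
      -- ℓ itself gets no axiom step
      objectiveSteps : 3 + Σℕ (O I) (axiomCost ∘ a ∘ proj₂) ≤ 3 * length (O I)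
      objectiveSteps with ∈-map⁻ proj₂ ℓ∈O
      ... | t , t∈O , refl = +Σℕ≤*length (O I) 3 (axiomCost≤3 ∘ a ∘ proj₂) t∈O
              (ℕₚ.≤-reflexive (cong (λ b → 3 + axiomCost (if b then 0 else objMultiplier ℓ))
                                    (isYes-true (ℓ ≟L ℓ) refl)))

    derivation : Derives (premises I v 𝒞) (clausePB L) (3 * length (O I) + 2 * length 𝒞 ∸ 2)
    derivation = Derives-weaken {T = clausePB L} length≤bound
      (clauseByDivision combined L G (Σℕ 𝒞 (suc ∘ κ) + e) G-bounds
        (negations-varInjective (consistent-∷ cons (proj₂ unassigned)) L⊆~ℓ∷α)
        flipped (addPair-≈ (+ e) ℓ (result combined)) litCoef-flipped G-∉ rhs-flipped)

  -- With μ = 1 a core with w_q = 1 and ℓ̄ ∈ K q would get multiplier 0, losing its literals; if such a core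
  -- exists, μ = 2 costs one scaling step but saves one step on that core.
  coreSetClause∨ : Consistent α → Compatible I 𝒞 → ∀ ℓ → ℓ ∈ objLits I → Unassigned α ℓ →
    v ≤ℤ residual I 𝒞 ℓ +ℤ + weight 𝒞 →
    Derives (premises I v 𝒞) (clausePB (coreSetLits 𝒞 ++ [ ~ ℓ ])) (3 * length (O I) + 2 * length 𝒞 ∸ 2)
  coreSetClause∨ cons compat ℓ ℓ∈O unassigned v≤ with Any.any? (λ q → (inK q ℓ ℕₚ.≟ 1) ×-dec (wt q ℕₚ.≟ 1)) 𝒞
  ... | yes tight = WithObjectiveLiteral.derivation cons compat ℓ∈O unassigned v≤ 1
    (λ q∈ → ℕₚ.≤-trans (s≤s (𝟙≤1 _)) (ℕₚ.*-monoʳ-≤ 2 (wt-pos q∈)))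
    (let (q , q∈ , inK≡1 , wt≡1) = find tight
     in +Σℕ≤*length 𝒞 1 (λ q → addCost≤2 (2 * wt q ∸ suc (inK q ℓ))) q∈
          (ℕₚ.≤-reflexive (cong₂ (λ b w → 1 + addCost (2 * w ∸ suc b)) inK≡1 wt≡1)))
  ... | no ¬tight = WithObjectiveLiteral.derivation cons compat ℓ∈O unassigned v≤ 0
    (λ {q} q∈ → room (inK q ℓ) (wt q) (𝟙≤1 _) (wt-pos q∈) (λ both → ¬tight (Any.map (λ { refl → both }) q∈)))
    (Σℕ≤*length 𝒞 (λ q → addCost≤2 (1 * wt q ∸ suc (inK q ℓ))))
    where
    room : ∀ b w → b ≤ 1 → 1 ≤ w → ¬ (b ≡ 1 × w ≡ 1) → suc b ≤ 1 * w
    room 0 w _ 1≤w _ = subst (1 ≤_) (sym (ℕₚ.*-identityˡ w)) 1≤w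
    room 1 1 _ _ not-both = ⊥-elim (not-both (refl , refl))
    room 1 (suc (suc w)) _ _ _ = s≤s (s≤s z≤n)
    room (suc (suc _)) _ (s≤s ()) _ _

theorem1 : (I : MaxSAT) (α : List Lit) → Consistent α → (v : ℤ) (𝒞 : List Core) →
    All (IsCore I α) 𝒞 → IsCoreSet 𝒞 → Compatible I 𝒞 →
    (v ≤ℤ + weight 𝒞 →
      Derives (premises I v 𝒞) (clausePB (coreSetLits 𝒞)) (3 * length (O I) + 2 * length 𝒞 + 1))
    × (∀ ℓ → ℓ ∈ objLits I → Unassigned α ℓ → v ≤ℤ residual I 𝒞 ℓ +ℤ + weight 𝒞 →
      Derives (premises I v 𝒞) (clausePB (coreSetLits 𝒞 ++ [ ~ ℓ ])) (3 * length (O I) + 2 * length 𝒞 ∸ 2))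
theorem1 I α cons v 𝒞 cores _ compat = coreSetClause cons compat , coreSetClause∨ cons compat
  where open Construction I α v 𝒞 cores
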